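{- Let $a$ and $d$ be integers with $a\ge 3$, $d>0$ and $\gcd(a,d)=1$, and let $A_3=\{a,a+d,a+2d\}$. For a nonnegative integer $n$ let $d(n;A_3)$ be the number of triples $(x_1,x_2,x_3)$ of nonnegative integers with $a x_1+(a+d)x_2+(a+2d)x_3=n$. For an integer $p\ge 0$ let $g_p(A_3)$ be the largest integer $n$ with $d(n;A_3)\le p$, and let $n_p(A_3)$ be the number of nonnegative integers $n$ with $d(n;A_3)\le p$. Then for every integer $p$ with $0\le p\le\lfloor a/2\rfloor$, $$g_p(a,a+d,a+2d)=(a+2d)p+\left\lfloor\frac{a-2}{2}\right\rfloor a+(a-1)d,$$ and $$n_p(a,a+d,a+2d)=\begin{cases}(2a+2d-1-p)p+\dfrac{(a-1)(a+2d-1)}{4}&\text{if $a$ is odd},\\[2mm] (2a+2d-1-p)p+\dfrac{(a-1)(a+2d-1)+1}{4}&\text{if $a$ is even}.\end{cases}$$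
   Context: $g_p$ is the $p$-Frobenius number (for $p=0$ the classical Frobenius number); $n_p$ is the $p$-genus (generalized Sylvester number). Both are finite since $\gcd(a,a+d,a+2d)=1$. -}

module Defs where

open import Data.Nat using (ℕ; zero; suc; _+_; _*_; _≤_; _<_; _≟_; _≤?_)
open import Data.List using (List; []; _∷_; length; filter; upTo; concatMap; map)
open import Data.Product using (_×_; _,_)

triplesUpTo : ℕ → List (ℕ × ℕ × ℕ)
triplesUpTo n =
  concatMap (λ x₁ → concatMap (λ x₂ → map (λ x₃ → (x₁ , x₂ , x₃)) (upTo (suc n))) (upTo (suc n))) (upTo (suc n))

-- d(n; a, b, c): number of (x₁,x₂,x₃) ∈ ℕ³ with a x₁ + b x₂ + c x₃ = n.
-- For a, b, c ≥ 1 every solution has xᵢ ≤ n, so enumerating {0..n}³ is exhaustive.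
-- (All uses below have a ≥ 3, b, c ≥ a.)
repCount : ℕ → ℕ → ℕ → ℕ → ℕ
repCount a b c n =
  length (filter (λ { (x₁ , x₂ , x₃) → a * x₁ + b * x₂ + c * x₃ ≟ n }) (triplesUpTo n))

countBelow : ℕ → ℕ → ℕ → ℕ → ℕ → ℕ
countBelow a b c p M = length (filter (λ n → repCount a b c n ≤? p) (upTo M))

module Submission where

-- Writing a x₁ + (a + d) x₂ + (a + 2d) x₃ = a k + d m with size k = x₁ + x₂ + x₃ and moment
-- m = x₂ + 2 x₃, the triples with a given (k, m) form a "fibre" of ⌊m/2⌋ + 1 ∸ (m ∸ k) elements.
-- Since gcd(a, d) = 1, every n has a unique M < a with n ≡ d M (mod a); either n = a K + d M, and
-- then the (k, m) of its representations are (K - d t, M + t a), or n < d M and n has none.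
-- For K < a + d only t ∈ {0, 1} occur, so the number of representations of a K + d M is a sum of
-- at most two fibre sizes, which is ≤ p exactly when K is below an explicit threshold T(M); beyond
-- it the number only grows along n ↦ n + a. Hence g_p = max_M (a (T(M) - 1) + d M) and
-- n_p = Σ_{M<a} (T(M) + ⌊d M / a⌋), and the floor sum is (a - 1)(d - 1)/2 by pairing M with a - M.

open import Defs
open import Data.Nat
open import Data.Nat.Properties
open import Data.Nat.DivMod
open import Data.Nat.Divisibility using (divides-refl)
open import Data.List using (List; []; _∷_; _++_; length; map; filter; concatMap; applyUpTo; upTo)
open import Data.List.Properties using (length-++; length-map; length-applyUpTo; length-upTo)
open import Data.List.Membership.Propositional using (_∈_; find; lose)
open import Data.List.Membership.Propositional.Properties
open import Data.List.Relation.Unary.Any using (here; there)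
open import Data.List.Relation.Unary.All using (lookup)
open import Data.List.Relation.Unary.AllPairs using ([]; _∷_)
open import Data.List.Relation.Unary.Unique.Propositional using (Unique)
import Data.List.Relation.Unary.Unique.Propositional.Properties as Unique
open import Data.Nat.GCD using (gcd; gcd-GCD; GCD; module Bézout)
open import Data.Product using (_×_; _,_; ∃; proj₁; proj₂)
open import Data.Empty using (⊥; ⊥-elim)
open import Data.Sum using (_⊎_; inj₁; inj₂)
open import Relation.Nullary using (Dec; yes; no)
open import Relation.Binary.PropositionalEquality
open import Data.Nat.Tactic.RingSolver using (solve-∀)

module _ {A : Set} where

  private
    remove : ∀ {x : A} {ys} → x ∈ ys → List A
    remove {ys = y ∷ ys} (here _)  = ys
    remove {ys = y ∷ ys} (there p) = y ∷ remove p

    length-remove : ∀ {x : A} {ys} (p : x ∈ ys) → suc (length (remove p)) ≡ length ys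
    length-remove {ys = y ∷ ys} (here _)  = refl
    length-remove {ys = y ∷ ys} (there p) = cong suc (length-remove p)

    ∈-remove : ∀ {x y : A} {ys} (p : x ∈ ys) → y ∈ ys → y ≢ x → y ∈ remove p
    ∈-remove (here refl) (here refl) y≢x = ⊥-elim (y≢x refl)
    ∈-remove (here refl) (there q)   _   = q
    ∈-remove (there p)   (here refl) _   = here refl
    ∈-remove (there p)   (there q)   y≢x = there (∈-remove p q y≢x)

  Unique-⊆⇒length-≤ : ∀ {xs ys : List A} → Unique xs → (∀ {z} → z ∈ xs → z ∈ ys) → length xs ≤ length ys
  Unique-⊆⇒length-≤ {[]}     _          _  = z≤n
  Unique-⊆⇒length-≤ {x ∷ xs} (x∉ ∷ xs!) xs⊆ys =
    subst (suc (length xs) ≤_) (length-remove x∈ys)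
      (s≤s (Unique-⊆⇒length-≤ xs! (λ z∈xs → ∈-remove x∈ys (xs⊆ys (there z∈xs)) (λ { refl → lookup x∉ z∈xs refl }))))
    where x∈ys = xs⊆ys (here refl)

module _ {A B : Set} (f : B → List A) where

  Unique-concatMap : ∀ {xs} → Unique xs → (∀ x → Unique (f x)) →
    (∀ {x y z} → x ∈ xs → y ∈ xs → z ∈ f x → z ∈ f y → x ≡ y) → Unique (concatMap f xs)
  Unique-concatMap {[]}     _          _  _   = []
  Unique-concatMap {x ∷ xs} (x∉ ∷ xs!) f! inj =
    Unique.++⁺ (f! x) (Unique-concatMap xs! f! (λ x∈ y∈ → inj (there x∈) (there y∈))) disjoint
    where
    disjoint : ∀ {v} → v ∈ f x × v ∈ concatMap f xs → ⊥
    disjoint (v∈fx , v∈rest) with find (∈-concatMap⁻ f {xs = xs} v∈rest)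
    ... | y , y∈xs , v∈fy = lookup x∉ y∈xs (inj (here refl) (there y∈xs) v∈fx v∈fy)

<∸⇒+< : ∀ x y j → j < x ∸ y → y + j < x
<∸⇒+< (suc x) zero    j lt = lt
<∸⇒+< (suc x) (suc y) j lt = s≤s (<∸⇒+< x y j lt)

+≡⇒≤ : ∀ {x y} z → x + z ≡ y → x ≤ y
+≡⇒≤ {x} z eq = subst (x ≤_) eq (m≤m+n x z)

[m+kn]/n≡m/n+k : ∀ m k n .{{_ : NonZero n}} → (m + k * n) / n ≡ m / n + k
[m+kn]/n≡m/n+k m k n = trans (+-distrib-/-∣ʳ m (divides-refl k)) (cong (m / n +_) (m*n/n≡m k n))

m<n⇒[m+kn]/n≡k : ∀ m k n .{{_ : NonZero n}} → m < n → (m + k * n) / n ≡ k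
m<n⇒[m+kn]/n≡k m k n m<n = trans ([m+kn]/n≡m/n+k m k n) (cong (_+ k) (m<n⇒m/n≡0 m<n))

m<n⇒[m+kn]%n≡m : ∀ m k n .{{_ : NonZero n}} → m < n → (m + k * n) % n ≡ m
m<n⇒[m+kn]%n≡m m k n m<n = trans ([m+kn]%n≡m%n m k n) (m<n⇒m%n≡m m<n)

-- Representations

Triple : Set
Triple = ℕ × ℕ × ℕ

Solves : ℕ → ℕ → ℕ → ℕ → Triple → Set
Solves a b c n (x₁ , x₂ , x₃) = a * x₁ + b * x₂ + c * x₃ ≡ n

solves? : ∀ a b c n t → Dec (Solves a b c n t)
solves? a b c n (x₁ , x₂ , x₃) = a * x₁ + b * x₂ + c * x₃ ≟ n

-- repCount a b c n is definitionally length (solutions a b c n).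
solutions : ℕ → ℕ → ℕ → ℕ → List Triple
solutions a b c n = filter (solves? a b c n) (triplesUpTo n)

private
  column : ℕ → ℕ → ℕ → List Triple
  column n x₁ x₂ = map (λ x₃ → (x₁ , x₂ , x₃)) (upTo (suc n))

  plane : ℕ → ℕ → List Triple
  plane n x₁ = concatMap (column n x₁) (upTo (suc n))

  ∈-column⁻ : ∀ n x₁ x₂ {t} → t ∈ column n x₁ x₂ → proj₁ t ≡ x₁ × proj₁ (proj₂ t) ≡ x₂
  ∈-column⁻ n x₁ x₂ t∈ with ∈-map⁻ (λ x₃ → (x₁ , x₂ , x₃)) t∈
  ... | _ , _ , refl = refl , refl

  ∈-plane⁻ : ∀ n x₁ {t} → t ∈ plane n x₁ → proj₁ t ≡ x₁
  ∈-plane⁻ n x₁ t∈ with find (∈-concatMap⁻ (column n x₁) {xs = upTo (suc n)} t∈)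
  ... | x₂ , _ , t∈col = proj₁ (∈-column⁻ n x₁ x₂ t∈col)

triplesUpTo-Unique : ∀ n → Unique (triplesUpTo n)
triplesUpTo-Unique n = Unique-concatMap (plane n) (Unique.upTo⁺ (suc n))
  (λ x₁ → Unique-concatMap (column n x₁) (Unique.upTo⁺ (suc n))
     (λ x₂ → Unique.map⁺ (λ { refl → refl }) (Unique.upTo⁺ (suc n)))
     (λ _ _ t∈x t∈y → trans (sym (proj₂ (∈-column⁻ n x₁ _ t∈x))) (proj₂ (∈-column⁻ n x₁ _ t∈y))))
  (λ _ _ t∈x t∈y → trans (sym (∈-plane⁻ n _ t∈x)) (∈-plane⁻ n _ t∈y))

∈-triplesUpTo : ∀ {n x₁ x₂ x₃} → x₁ ≤ n → x₂ ≤ n → x₃ ≤ n → (x₁ , x₂ , x₃) ∈ triplesUpTo n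
∈-triplesUpTo {n} {x₁} {x₂} x₁≤n x₂≤n x₃≤n =
  ∈-concatMap⁺ (plane n) (lose (∈-upTo⁺ (s≤s x₁≤n))
    (∈-concatMap⁺ (column n x₁) (lose (∈-upTo⁺ (s≤s x₂≤n))
      (∈-map⁺ (λ x₃ → (x₁ , x₂ , x₃)) (∈-upTo⁺ (s≤s x₃≤n))))))

module Counting (a b c : ℕ) {{_ : NonZero a}} {{_ : NonZero b}} {{_ : NonZero c}} where

  ∈-solutions⁺ : ∀ {n} t → Solves a b c n t → t ∈ solutions a b c n
  ∈-solutions⁺ {n} (x₁ , x₂ , x₃) eq = ∈-filter⁺ (solves? a b c n) (∈-triplesUpTo x₁≤n x₂≤n x₃≤n) eq
    where
    x₁≤n : x₁ ≤ n
    x₁≤n = ≤-trans (m≤n*m x₁ a) (≤-trans (m≤m+n (a * x₁) (b * x₂)) (≤-trans (m≤m+n _ (c * x₃)) (≤-reflexive eq)))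
    x₂≤n : x₂ ≤ n
    x₂≤n = ≤-trans (m≤n*m x₂ b) (≤-trans (m≤n+m (b * x₂) (a * x₁)) (≤-trans (m≤m+n _ (c * x₃)) (≤-reflexive eq)))
    x₃≤n : x₃ ≤ n
    x₃≤n = ≤-trans (m≤n*m x₃ c) (≤-trans (m≤n+m (c * x₃) _) (≤-reflexive eq))

  ∈-solutions⁻ : ∀ {n t} → t ∈ solutions a b c n → Solves a b c n t
  ∈-solutions⁻ {n} t∈ = proj₂ (∈-filter⁻ (solves? a b c n) t∈)

  solutions-Unique : ∀ n → Unique (solutions a b c n)
  solutions-Unique n = Unique.filter⁺ (solves? a b c n) (triplesUpTo-Unique n)

  repCount-≥ : ∀ {n} (L : List Triple) → Unique L → (∀ {t} → t ∈ L → Solves a b c n t) → length L ≤ repCount a b c n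
  repCount-≥ L L! sound = Unique-⊆⇒length-≤ L! (λ {t} t∈ → ∈-solutions⁺ t (sound t∈))

  repCount-≤ : ∀ {n} (L : List Triple) → (∀ t → Solves a b c n t → t ∈ L) → repCount a b c n ≤ length L
  repCount-≤ {n} L complete = Unique-⊆⇒length-≤ (solutions-Unique n) (λ {t} t∈ → complete t (∈-solutions⁻ t∈))

  repCount-mono-+a : ∀ n → repCount a b c n ≤ repCount a b c (a + n)
  repCount-mono-+a n = subst (_≤ repCount a b c (a + n)) (length-map bump (solutions a b c n))
    (repCount-≥ (map bump (solutions a b c n)) (Unique.map⁺ bump-injective (solutions-Unique n)) sound)
    where
    bump : Triple → Triple
    bump (x₁ , x₂ , x₃) = (suc x₁ , x₂ , x₃)
    bump-injective : ∀ {t u} → bump t ≡ bump u → t ≡ u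
    bump-injective {_ , _ , _} {_ , _ , _} refl = refl
    shift : ∀ a b c x₁ x₂ x₃ → a * suc x₁ + b * x₂ + c * x₃ ≡ a + (a * x₁ + b * x₂ + c * x₃)
    shift = solve-∀
    sound : ∀ {t} → t ∈ map bump (solutions a b c n) → Solves a b c (a + n) t
    sound t∈ with ∈-map⁻ bump t∈
    ... | (x₁ , x₂ , x₃) , t∈sol , refl = trans (shift a b c x₁ x₂ x₃) (cong (a +_) (∈-solutions⁻ t∈sol))

  repCount-mono-+a* : ∀ j n → repCount a b c n ≤ repCount a b c (a * j + n)
  repCount-mono-+a* zero    n = ≤-reflexive (cong (λ z → repCount a b c (z + n)) (sym (*-zeroʳ a)))
  repCount-mono-+a* (suc j) n = ≤-trans (repCount-mono-+a* j n) (≤-trans (repCount-mono-+a (a * j + n))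
    (≤-reflexive (cong (repCount a b c) (trans (sym (+-assoc a (a * j) n)) (cong (_+ n) (sym (*-suc a j)))))))

-- Fibres of size and moment

size : Triple → ℕ
size (x₁ , x₂ , x₃) = x₁ + x₂ + x₃

moment : Triple → ℕ
moment (x₁ , x₂ , x₃) = x₂ + 2 * x₃

fibreSize : ℕ → ℕ → ℕ
fibreSize k m = suc (m / 2) ∸ (m ∸ k)

-- The triples of size k and moment m, listed by x₃, which ranges over m ∸ k ≤ x₃ ≤ ⌊m/2⌋.
fibre : ℕ → ℕ → List Triple
fibre k m = map withThird (applyUpTo ((m ∸ k) +_) (fibreSize k m))
  where
  withThird : ℕ → Triple
  withThird x₃ = (k ∸ (m ∸ 2 * x₃) ∸ x₃ , m ∸ 2 * x₃ , x₃)

fibre-length : ∀ k m → length (fibre k m) ≡ fibreSize k m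
fibre-length k m = trans (length-map _ (applyUpTo ((m ∸ k) +_) (fibreSize k m))) (length-applyUpTo _ (fibreSize k m))

fibre-Unique : ∀ k m → Unique (fibre k m)
fibre-Unique k m = Unique.map⁺ (cong (λ t → proj₂ (proj₂ t)))
  (Unique.applyUpTo⁺₁ ((m ∸ k) +_) (fibreSize k m) (λ i<j _ eq → <⇒≢ i<j (+-cancelˡ-≡ (m ∸ k) _ _ eq)))

∈-fibre⁻ : ∀ k m {t} → t ∈ fibre k m → size t ≡ k × moment t ≡ m
∈-fibre⁻ k m t∈ with ∈-map⁻ _ t∈
... | third , third∈ , refl with ∈-applyUpTo⁻ ((m ∸ k) +_) third∈
... | j , j<size , refl = size≡k , moment≡m
  where
  x₃ = m ∸ k + j
  x₂ = m ∸ 2 * x₃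
  x₃≤m/2 : x₃ ≤ m / 2
  x₃≤m/2 = s≤s⁻¹ (<∸⇒+< (suc (m / 2)) (m ∸ k) j j<size)
  moment≡m : x₂ + 2 * x₃ ≡ m
  moment≡m = m∸n+n≡m (≤-trans (≤-reflexive (*-comm 2 x₃)) (≤-trans (*-monoˡ-≤ 2 x₃≤m/2) (m/n*n≤m m 2)))
  size≡k : k ∸ x₂ ∸ x₃ + x₂ + x₃ ≡ k
  size≡k = begin
    k ∸ x₂ ∸ x₃ + x₂ + x₃     ≡⟨ +-assoc (k ∸ x₂ ∸ x₃) x₂ x₃ ⟩
    k ∸ x₂ ∸ x₃ + (x₂ + x₃)   ≡⟨ cong (_+ (x₂ + x₃)) (∸-+-assoc k x₂ x₃) ⟩
    k ∸ (x₂ + x₃) + (x₂ + x₃) ≡⟨ m∸n+n≡m x₂+x₃≤k ⟩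
    k                         ∎
    where
    open ≡-Reasoning
    double : ∀ u v → u + v + v ≡ u + 2 * v
    double = solve-∀
    x₂+x₃≤k : x₂ + x₃ ≤ k
    x₂+x₃≤k = +-cancelʳ-≤ x₃ (x₂ + x₃) k (≤-trans (≤-reflexive (trans (double x₂ x₃) moment≡m))
      (≤-trans (m≤n+m∸n m k) (+-monoʳ-≤ k (m≤m+n (m ∸ k) j))))

∈-fibre⁺ : ∀ x₁ x₂ x₃ → (x₁ , x₂ , x₃) ∈ fibre (x₁ + x₂ + x₃) (x₂ + 2 * x₃)
∈-fibre⁺ x₁ x₂ x₃ = subst (_∈ fibre k m) same (∈-map⁺ _ (∈-applyUpTo⁺ ((m ∸ k) +_) j<size))
  where
  k = x₁ + x₂ + x₃
  m = x₂ + 2 * x₃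
  lift : ∀ x₁ x₂ x₃ → x₁ + (x₂ + 2 * x₃) ≡ x₁ + x₂ + x₃ + x₃
  lift = solve-∀
  m∸k≤x₃ : m ∸ k ≤ x₃
  m∸k≤x₃ = m≤n+o⇒m∸n≤o m k (≤-trans (m≤n+m m x₁) (≤-reflexive (lift x₁ x₂ x₃)))
  x₃≤m/2 : x₃ ≤ m / 2
  x₃≤m/2 = ≤-trans (≤-reflexive (sym (m*n/n≡m x₃ 2)))
    (/-monoˡ-≤ 2 (≤-trans (≤-reflexive (*-comm x₃ 2)) (m≤n+m (2 * x₃) x₂)))
  j = x₃ ∸ (m ∸ k)
  j<size : j < fibreSize k m
  j<size = ∸-monoˡ-< (s≤s x₃≤m/2) m∸k≤x₃
  x₂≡ : m ∸ 2 * x₃ ≡ x₂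
  x₂≡ = m+n∸n≡m x₂ (2 * x₃)
  x₁≡ : k ∸ x₂ ∸ x₃ ≡ x₁
  x₁≡ = trans (∸-+-assoc k x₂ x₃) (trans (cong (_∸ (x₂ + x₃)) (+-assoc x₁ x₂ x₃)) (m+n∸n≡m x₁ (x₂ + x₃)))
  same : (k ∸ (m ∸ 2 * (m ∸ k + j)) ∸ (m ∸ k + j) , m ∸ 2 * (m ∸ k + j) , m ∸ k + j) ≡ (x₁ , x₂ , x₃)
  same rewrite m+[n∸m]≡n m∸k≤x₃ | x₂≡ | x₁≡ = refl

fibreSize-≤ : ∀ k m z → suc (m / 2) + k ≤ z + m → fibreSize k m ≤ z
fibreSize-≤ k m z le = m≤n+o⇒m∸n≤o (suc (m / 2)) (m ∸ k)
  (+-cancelʳ-≤ k (suc (m / 2)) (m ∸ k + z)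
    (≤-trans le (≤-trans (+-monoʳ-≤ z (m≤n+m∸n m k)) (≤-reflexive (rearrange z k (m ∸ k))))))
  where
  rearrange : ∀ z k w → z + (k + w) ≡ w + z + k
  rearrange = solve-∀

progression-weight : ∀ a d x₁ x₂ x₃ →
  a * x₁ + (a + d) * x₂ + (a + 2 * d) * x₃ ≡ a * (x₁ + x₂ + x₃) + d * (x₂ + 2 * x₃)
progression-weight = solve-∀

fibre⊆solutions : ∀ a d K M {t} → t ∈ fibre K M → Solves a (a + d) (a + 2 * d) (a * K + d * M) t
fibre⊆solutions a d K M {x₁ , x₂ , x₃} t∈ with ∈-fibre⁻ K M t∈
... | size≡K , moment≡M = trans (progression-weight a d x₁ x₂ x₃) (cong₂ (λ k m → a * k + d * m) size≡K moment≡M)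

shifted-fibre⊆solutions : ∀ a d K M {t} → d ≤ K → t ∈ fibre (K ∸ d) (M + a) →
  Solves a (a + d) (a + 2 * d) (a * K + d * M) t
shifted-fibre⊆solutions a d K M d≤K t∈ = trans (fibre⊆solutions a d (K ∸ d) (M + a) t∈)
  (trans (rearrange a d (K ∸ d) M) (cong (λ k → a * k + d * M) (m∸n+n≡m d≤K)))
  where
  rearrange : ∀ a d k M → a * k + d * (M + a) ≡ a * (k + d) + d * M
  rearrange = solve-∀

fibres-Unique : ∀ k m k′ m′ → m ≢ m′ → Unique (fibre k m ++ fibre k′ m′)
fibres-Unique k m k′ m′ m≢m′ = Unique.++⁺ (fibre-Unique k m) (fibre-Unique k′ m′)
  (λ (t∈ , t∈′) → m≢m′ (trans (sym (proj₂ (∈-fibre⁻ k m t∈))) (proj₂ (∈-fibre⁻ k′ m′ t∈′))))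

-- Residues modulo a

modular-inverse : ∀ a d .{{_ : NonZero a}} → gcd a d ≡ 1 → ∃ λ e → (d * e) % a ≡ 1 % a
modular-inverse a@(suc a₁) d gcd≡1 with Bézout.identity (subst (GCD a d) gcd≡1 (gcd-GCD a d))
... | Bézout.+- x y eq = y * a₁ , (begin
  d * (y * a₁) % a            ≡⟨ [m+n]%n≡m%n (d * (y * a₁)) a ⟨
  (d * (y * a₁) + a) % a      ≡⟨ cong (_% a) (rearrange d y a₁) ⟩
  ((1 + y * d) * a₁ + 1) % a  ≡⟨ cong (λ z → (z * a₁ + 1) % a) eq ⟩
  (x * a * a₁ + 1) % a        ≡⟨ cong (_% a) (rearrange′ x a₁) ⟩
  (1 + x * a₁ * a) % a        ≡⟨ [m+kn]%n≡m%n 1 (x * a₁) a ⟩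
  1 % a                       ∎)
  where
  open ≡-Reasoning
  rearrange : ∀ d y a₁ → d * (y * a₁) + suc a₁ ≡ (1 + y * d) * a₁ + 1
  rearrange = solve-∀
  rearrange′ : ∀ x a₁ → x * suc a₁ * a₁ + 1 ≡ 1 + x * a₁ * suc a₁
  rearrange′ = solve-∀
... | Bézout.-+ x y eq = y , trans (cong (_% a) (trans (*-comm d y) (sym eq))) ([m+kn]%n≡m%n 1 x a)

module Residues (a d : ℕ) .{{_ : NonZero a}} (gcd≡1 : gcd a d ≡ 1) where

  private
    e = proj₁ (modular-inverse a d gcd≡1)

    recover : ∀ x → x % a ≡ ((d * x) % a * (e % a)) % a
    recover x = begin
      x % a                          ≡⟨ cong (_% a) (*-identityʳ x) ⟨
      (x * 1) % a                    ≡⟨ %-distribˡ-* x 1 a ⟩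
      (x % a * (1 % a)) % a          ≡⟨ cong (λ z → (x % a * z) % a) (proj₂ (modular-inverse a d gcd≡1)) ⟨
      (x % a * ((d * e) % a)) % a    ≡⟨ %-distribˡ-* x (d * e) a ⟨
      (x * (d * e)) % a              ≡⟨ cong (_% a) (swap x d e) ⟩
      (d * x * e) % a                ≡⟨ %-distribˡ-* (d * x) e a ⟩
      ((d * x) % a * (e % a)) % a    ∎
      where
      open ≡-Reasoning
      swap : ∀ x y z → x * (y * z) ≡ y * x * z
      swap = solve-∀

  *-cancelˡ-% : ∀ x y → (d * x) % a ≡ (d * y) % a → x % a ≡ y % a
  *-cancelˡ-% x y eq = trans (recover x) (trans (cong (λ z → (z * (e % a)) % a) eq) (sym (recover y)))

  residue-representative : ∀ n → ∃ λ M → M < a × (d * M) % a ≡ n % a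
  residue-representative n = (n * e) % a , m%n<n (n * e) a , (begin
    (d * ((n * e) % a)) % a            ≡⟨ %-distribˡ-* d ((n * e) % a) a ⟩
    (d % a * ((n * e) % a % a)) % a    ≡⟨ cong (λ z → (d % a * z) % a) (m%n%n≡m%n (n * e) a) ⟩
    (d % a * ((n * e) % a)) % a        ≡⟨ %-distribˡ-* d (n * e) a ⟨
    (d * (n * e)) % a                  ≡⟨ cong (_% a) (swap d n e) ⟩
    (n * (d * e)) % a                  ≡⟨ %-distribˡ-* n (d * e) a ⟩
    (n % a * ((d * e) % a)) % a        ≡⟨ cong (λ z → (n % a * z) % a) (proj₂ (modular-inverse a d gcd≡1)) ⟩
    (n % a * (1 % a)) % a              ≡⟨ %-distribˡ-* n 1 a ⟨
    (n * 1) % a                        ≡⟨ cong (_% a) (*-identityʳ n) ⟩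
    n % a                              ∎)
    where
    open ≡-Reasoning
    swap : ∀ x y z → x * (y * z) ≡ y * (x * z)
    swap = solve-∀

  private
    residue-of-weight : ∀ k m → (a * k + d * m) % a ≡ (d * m) % a
    residue-of-weight k m = trans (cong (_% a) (trans (+-comm (a * k) (d * m)) (cong (d * m +_) (*-comm a k))))
                                  ([m+kn]%n≡m%n (d * m) k a)

  weight-shift : ∀ k m K M → a * k + d * m ≡ a * K + d * M → M < a →
    ∃ λ t → m ≡ M + t * a × K ≡ k + d * t
  weight-shift k m K M eq M<a = t , m≡ , sym (*-cancelˡ-≡ (k + d * t) K a
      (+-cancelʳ-≡ (d * M) _ _ (trans (sym (rearrange a d k M t)) (trans (cong (λ z → a * k + d * z) (sym m≡)) eq))))
    where
    rearrange : ∀ a d k M t → a * k + d * (M + t * a) ≡ a * (k + d * t) + d * M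
    rearrange = solve-∀
    t = m / a
    m%a≡M : m % a ≡ M
    m%a≡M = trans (*-cancelˡ-% m M (trans (sym (residue-of-weight k m)) (trans (cong (_% a) eq) (residue-of-weight K M))))
                  (m<n⇒m%n≡m M<a)
    m≡ : m ≡ M + t * a
    m≡ = trans (m≡m%n+[m/n]*n m a) (cong (_+ t * a) m%a≡M)

  weight-not-below-residue : ∀ k m M J → a * k + d * m + a * suc J ≡ d * M → M < a → ⊥
  weight-not-below-residue k m M J eq M<a = <-irrefl refl (begin-strict
    d * M                        <⟨ m<m+n (d * M) (≤-trans (>-nonZero⁻¹ a) (m≤m*n a (suc J))) ⟩
    d * M + a * suc J            ≤⟨ +-monoˡ-≤ (a * suc J) (*-monoʳ-≤ d M≤m) ⟩
    d * m + a * suc J            ≤⟨ +-monoˡ-≤ (a * suc J) (m≤n+m (d * m) (a * k)) ⟩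
    a * k + d * m + a * suc J    ≡⟨ eq ⟩
    d * M                        ∎)
    where
    open ≤-Reasoning
    rearrange : ∀ a d k m J → a * k + d * m + a * J ≡ a * (k + J) + d * m
    rearrange = solve-∀
    m%a≡M : m % a ≡ M
    m%a≡M = trans (*-cancelˡ-% m M (trans (sym (residue-of-weight (k + suc J) m))
                    (trans (cong (_% a) (sym (rearrange a d k m (suc J)))) (cong (_% a) eq))))
                  (m<n⇒m%n≡m M<a)
    M≤m : M ≤ m
    M≤m = ≤-trans (≤-reflexive (sym m%a≡M)) (m%n≤m m a)

  private
    shift-by-two-impossible : ∀ k m K → m ≤ k + k → a + a ≤ m → k + (d + d) ≤ K → K < a + d → ⊥
    shift-by-two-impossible k m K m≤2k 2a≤m k+2d≤K K<a+d = <-irrefl refl (begin-strict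
      K + K                        <⟨ +-mono-< K<a+d K<a+d ⟩
      a + d + (a + d)              ≤⟨ +≡⇒≤ (d + d) (rearrange a d) ⟩
      a + a + (d + d + (d + d))    ≤⟨ +-monoˡ-≤ (d + d + (d + d)) (≤-trans 2a≤m m≤2k) ⟩
      k + k + (d + d + (d + d))    ≡⟨ rearrange′ k d ⟩
      k + (d + d) + (k + (d + d))  ≤⟨ +-mono-≤ k+2d≤K k+2d≤K ⟩
      K + K                        ∎)
      where
      open ≤-Reasoning
      rearrange : ∀ a d → a + d + (a + d) + (d + d) ≡ a + a + (d + d + (d + d))
      rearrange = solve-∀
      rearrange′ : ∀ k d → k + k + (d + d + (d + d)) ≡ k + (d + d) + (k + (d + d))
      rearrange′ = solve-∀

  solutions⊆fibres : ∀ K M → M < a → K < a + d → ∀ t → Solves a (a + d) (a + 2 * d) (a * K + d * M) t →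
    t ∈ fibre K M ++ fibre (K ∸ d) (M + a)
  solutions⊆fibres K M M<a K<a+d (x₁ , x₂ , x₃) eq
    with weight-shift (x₁ + x₂ + x₃) (x₂ + 2 * x₃) K M (trans (sym (progression-weight a d x₁ x₂ x₃)) eq) M<a
  ... | 0 , m≡ , K≡ = ∈-++⁺ˡ (subst₂ (λ k m → (x₁ , x₂ , x₃) ∈ fibre k m)
          (trans (sym (+-identityʳ _)) (trans (cong (x₁ + x₂ + x₃ +_) (sym (*-zeroʳ d))) (sym K≡)))
          (trans m≡ (+-identityʳ M)) (∈-fibre⁺ x₁ x₂ x₃))
  ... | 1 , m≡ , K≡ = ∈-++⁺ʳ (fibre K M) (subst₂ (λ k m → (x₁ , x₂ , x₃) ∈ fibre k m)
          (sym (trans (cong (_∸ d) (trans K≡ (cong (x₁ + x₂ + x₃ +_) (*-identityʳ d)))) (m+n∸n≡m _ d)))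
          (trans m≡ (cong (M +_) (+-identityʳ a))) (∈-fibre⁺ x₁ x₂ x₃))
  ... | suc (suc t) , m≡ , K≡ = ⊥-elim (shift-by-two-impossible (x₁ + x₂ + x₃) (x₂ + 2 * x₃) K
          (+≡⇒≤ (x₁ + x₁ + x₂) (twice-size x₁ x₂ x₃))
          (≤-trans (+≡⇒≤ (t * a) (rearrange a t)) (≤-trans (m≤n+m _ M) (≤-reflexive (sym m≡))))
          (≤-trans (+-monoʳ-≤ (x₁ + x₂ + x₃) (+≡⇒≤ (d * t) (rearrange′ d t))) (≤-reflexive (sym K≡)))
          K<a+d)
    where
    twice-size : ∀ x₁ x₂ x₃ → x₂ + 2 * x₃ + (x₁ + x₁ + x₂) ≡ x₁ + x₂ + x₃ + (x₁ + x₂ + x₃)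
    twice-size = solve-∀
    rearrange : ∀ a t → a + a + t * a ≡ a + (a + t * a)
    rearrange = solve-∀
    rearrange′ : ∀ d t → d + d + d * t ≡ d * suc (suc t)
    rearrange′ = solve-∀

above-or-below : ∀ n r a .{{_ : NonZero a}} → r % a ≡ n % a →
  (∃ λ K → n ≡ a * K + r) ⊎ (∃ λ J → n + a * suc J ≡ r)
above-or-below n r a eq with r / a ≤? n / a
... | yes r/a≤n/a = inj₁ (n / a ∸ r / a , (begin
  n                                        ≡⟨ m≡m%n+[m/n]*n n a ⟩
  n % a + n / a * a                        ≡⟨ cong (λ z → n % a + z * a) (m+[n∸m]≡n r/a≤n/a) ⟨
  n % a + (r / a + (n / a ∸ r / a)) * a    ≡⟨ rearrange (n % a) (r / a) (n / a ∸ r / a) a ⟩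
  a * (n / a ∸ r / a) + (n % a + r / a * a) ≡⟨ cong (λ z → a * (n / a ∸ r / a) + (z + r / a * a)) eq ⟨
  a * (n / a ∸ r / a) + (r % a + r / a * a) ≡⟨ cong (a * (n / a ∸ r / a) +_) (m≡m%n+[m/n]*n r a) ⟨
  a * (n / a ∸ r / a) + r                  ∎))
  where
  open ≡-Reasoning
  rearrange : ∀ R q K a → R + (q + K) * a ≡ a * K + (R + q * a)
  rearrange = solve-∀
... | no r/a≰n/a = inj₂ (gap , (begin
  n + a * suc gap                  ≡⟨ cong (λ z → z + a * suc gap) (m≡m%n+[m/n]*n n a) ⟩
  n % a + n / a * a + a * suc gap  ≡⟨ rearrange (n % a) (n / a) gap a ⟩
  n % a + (suc (n / a) + gap) * a  ≡⟨ cong₂ (λ x y → x + y * a) (sym eq) (m+[n∸m]≡n (≰⇒> r/a≰n/a)) ⟩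
  r % a + r / a * a                ≡⟨ m≡m%n+[m/n]*n r a ⟨
  r                                ∎))
  where
  open ≡-Reasoning
  gap = r / a ∸ suc (n / a)
  rearrange : ∀ R q J a → R + q * a + a * suc J ≡ R + (suc q + J) * a
  rearrange = solve-∀

-- Finite sums

sumBelow : (ℕ → ℕ) → ℕ → ℕ
sumBelow f zero    = 0
sumBelow f (suc n) = sumBelow f n + f n

sumBelow-suc : ∀ f n → sumBelow f (suc n) ≡ f 0 + sumBelow (λ i → f (suc i)) n
sumBelow-suc f zero    = +-comm 0 (f 0)
sumBelow-suc f (suc n) = trans (cong (_+ f (suc n)) (sumBelow-suc f n)) (+-assoc (f 0) _ (f (suc n)))

sumBelow-cong : ∀ f g n → (∀ i → i < n → f i ≡ g i) → sumBelow f n ≡ sumBelow g n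
sumBelow-cong f g zero    f≗g = refl
sumBelow-cong f g (suc n) f≗g = cong₂ _+_ (sumBelow-cong f g n (λ i i<n → f≗g i (m<n⇒m<1+n i<n))) (f≗g n ≤-refl)

sumBelow-+ : ∀ f g n → sumBelow (λ i → f i + g i) n ≡ sumBelow f n + sumBelow g n
sumBelow-+ f g zero    = refl
sumBelow-+ f g (suc n) = trans (cong (_+ (f n + g n)) (sumBelow-+ f g n)) (+-+-comm (sumBelow f n) (sumBelow g n) (f n) (g n))
  where
  +-+-comm : ∀ A B x y → A + B + (x + y) ≡ A + x + (B + y)
  +-+-comm = solve-∀

sumBelow-const : ∀ c n → sumBelow (λ _ → c) n ≡ n * c
sumBelow-const c zero    = refl
sumBelow-const c (suc n) = trans (cong (_+ c) (sumBelow-const c n)) (+-comm (n * c) c)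

sumBelow-split : ∀ f m n → sumBelow f (m + n) ≡ sumBelow f m + sumBelow (λ j → f (m + j)) n
sumBelow-split f m zero    = trans (cong (sumBelow f) (+-identityʳ m)) (sym (+-identityʳ _))
sumBelow-split f m (suc n) = trans (cong (sumBelow f) (+-suc m n))
  (trans (cong (_+ f (m + n)) (sumBelow-split f m n)) (+-assoc (sumBelow f m) _ (f (m + n))))

sumBelow-pairs : ∀ f k → sumBelow f (k * 2) ≡ sumBelow (λ i → f (i * 2) + f (1 + i * 2)) k
sumBelow-pairs f zero    = refl
sumBelow-pairs f (suc k) = trans (+-assoc (sumBelow f (k * 2)) (f (k * 2)) (f (suc (k * 2))))
  (cong (_+ (f (k * 2) + f (1 + k * 2))) (sumBelow-pairs f k))

sumBelow-reverse : ∀ f n → sumBelow f n ≡ sumBelow (λ j → f (n ∸ suc j)) n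
sumBelow-reverse f zero    = refl
sumBelow-reverse f (suc n) = trans (cong (_+ f n) (sumBelow-reverse f n))
  (trans (+-comm _ (f n)) (sym (sumBelow-suc (λ j → f (suc n ∸ suc j)) n)))

sumBelow-odd : ∀ c q → sumBelow (λ j → c + 1 + j * 2) q ≡ q * (q + c)
sumBelow-odd c zero    = refl
sumBelow-odd c (suc q) = trans (cong (_+ (c + 1 + q * 2)) (sumBelow-odd c q)) (step c q)
  where
  step : ∀ c q → q * (q + c) + (c + 1 + q * 2) ≡ suc q * (suc q + c)
  step = solve-∀

length-concatMap-applyUpTo : {A : Set} (g : ℕ → List A) → ∀ f n →
  length (concatMap g (applyUpTo f n)) ≡ sumBelow (λ i → length (g (f i))) n
length-concatMap-applyUpTo g f zero    = refl
length-concatMap-applyUpTo g f (suc n) = trans (length-++ (g (f 0)))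
  (trans (cong (length (g (f 0)) +_) (length-concatMap-applyUpTo g (λ i → f (suc i)) n))
    (sym (sumBelow-suc (λ i → length (g (f i))) n)))

-- Reciprocity for floor sums: ⌊d M / a⌋ + ⌊d (a - M) / a⌋ = d - 1 for 0 < M < a, since a ∤ d M.
module FloorSum (a₁ d₀ : ℕ) (gcd≡1 : gcd (suc a₁) (suc d₀) ≡ 1) where

  private
    a d : ℕ
    a = suc a₁
    d = suc d₀

    open Residues a d gcd≡1

    q : ℕ → ℕ
    q M = d * M / a

    complementary : ∀ M M′ → 1 ≤ M → M < a → M + M′ ≡ a → q M + q M′ ≡ d₀
    complementary M M′ 1≤M M<a M+M′≡a = trans (cong (q M +_) qM′≡) (m+[n∸m]≡n qM≤d₀)
      where
      R = (d * M) % a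
      dM≡ : d * M ≡ R + q M * a
      dM≡ = m≡m%n+[m/n]*n (d * M) a
      R≢0 : R ≢ 0
      R≢0 R≡0 = <-irrefl refl (≤-trans 1≤M (≤-reflexive (trans (sym (m<n⇒m%n≡m M<a))
                  (*-cancelˡ-% M 0 (trans R≡0 (sym (cong (_% a) (*-zeroʳ d))))))))
      R≤a : R ≤ a
      R≤a = m%n≤n (d * M) a
      qM<d : q M < d
      qM<d = *-cancelʳ-< a (q M) d (begin-strict
        q M * a     ≤⟨ m/n*n≤m (d * M) a ⟩
        d * M       <⟨ *-monoʳ-< d M<a ⟩
        d * a       ∎)
        where open ≤-Reasoning
      qM≤d₀ : q M ≤ d₀
      qM≤d₀ = s≤s⁻¹ qM<d
      R′ = a ∸ R
      q′ = d₀ ∸ q M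
      dM′≡ : d * M′ ≡ R′ + q′ * a
      dM′≡ = +-cancelʳ-≡ (d * M) _ _ (begin-equality
        d * M′ + d * M                     ≡⟨ *-distribˡ-+ d M′ M ⟨
        d * (M′ + M)                       ≡⟨ cong (d *_) (trans (+-comm M′ M) M+M′≡a) ⟩
        d * a                              ≡⟨ cong₂ (λ x y → x + y * a) (m∸n+n≡m R≤a) (m∸n+n≡m qM≤d₀) ⟨
        (R′ + R) + (q′ + q M) * a          ≡⟨ rearrange R′ q′ R (q M) a ⟩
        R′ + q′ * a + (R + q M * a)        ≡⟨ cong (R′ + q′ * a +_) dM≡ ⟨
        R′ + q′ * a + d * M                ∎)
        where
        open ≤-Reasoning
        rearrange : ∀ R′ q′ R q a → (R′ + R) + (q′ + q) * a ≡ R′ + q′ * a + (R + q * a)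
        rearrange = solve-∀
      qM′≡ : q M′ ≡ q′
      qM′≡ = trans (cong (_/ a) dM′≡) (m<n⇒[m+kn]/n≡k R′ q′ a (∸-monoʳ-< {a} {R} {0} (n≢0⇒n>0 R≢0) R≤a))

  floor-sum : sumBelow (λ M → d * M / a) a * 2 ≡ a₁ * d₀
  floor-sum = begin
    sumBelow q a * 2                              ≡⟨ *-comm (sumBelow q a) 2 ⟩
    sumBelow q a + (sumBelow q a + 0)             ≡⟨ cong (λ z → z + (z + 0)) drop-zero ⟩
    sumBelow g a₁ + (sumBelow g a₁ + 0)           ≡⟨ cong (sumBelow g a₁ +_) (+-identityʳ _) ⟩
    sumBelow g a₁ + sumBelow g a₁                 ≡⟨ cong (sumBelow g a₁ +_) (sumBelow-reverse g a₁) ⟩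
    sumBelow g a₁ + sumBelow (λ j → g (a₁ ∸ suc j)) a₁  ≡⟨ sumBelow-+ g (λ j → g (a₁ ∸ suc j)) a₁ ⟨
    sumBelow (λ j → g j + g (a₁ ∸ suc j)) a₁     ≡⟨ sumBelow-cong _ (λ _ → d₀) a₁ paired ⟩
    sumBelow (λ _ → d₀) a₁                        ≡⟨ sumBelow-const d₀ a₁ ⟩
    a₁ * d₀                                       ∎
    where
    open ≡-Reasoning
    g : ℕ → ℕ
    g j = q (suc j)
    drop-zero : sumBelow q a ≡ sumBelow g a₁
    drop-zero = trans (sumBelow-suc q a₁) (cong (_+ sumBelow g a₁) (trans (cong (_/ a) (*-zeroʳ d)) (0/n≡0 a)))
    paired : ∀ j → j < a₁ → g j + g (a₁ ∸ suc j) ≡ d₀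
    paired j j<a₁ = complementary (suc j) (suc (a₁ ∸ suc j)) (s≤s z≤n) (s≤s j<a₁)
                      (cong suc (trans (+-suc j (a₁ ∸ suc j)) (m+[n∸m]≡n j<a₁)))

module Sylvester (a₀ d₀ : ℕ) (gcd≡1 : gcd (3 + a₀) (suc d₀) ≡ 1) (p : ℕ) (p≤a/2 : p ≤ (3 + a₀) / 2) where

  a₁ a d : ℕ
  a₁ = 2 + a₀
  a = suc a₁
  d = suc d₀

  rc : ℕ → ℕ
  rc = repCount a (a + d) (a + 2 * d)

  open Residues a d gcd≡1
  open Counting a (a + d) (a + 2 * d)
  open FloorSum a₁ d₀ gcd≡1

  h s : ℕ
  h = a / 2
  s = a % 2

  s<2 : s < 2
  s<2 = m%n<n a 2

  a≡s+h*2 : a ≡ s + h * 2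
  a≡s+h*2 = m≡m%n+[m/n]*n a 2

  1≤h : 1 ≤ h
  1≤h = m≥n⇒m/n>0 {a} {2} (s≤s (s≤s z≤n))

  lowThreshold : ℕ → ℕ
  lowThreshold r = h + d + (p ∸ 1) + ⌈ r + s /2⌉

  -- For a moment M = r + 2i (r < 2): rc (a K + d M) ≤ p exactly when K < threshold′ i r.
  threshold′ : ℕ → ℕ → ℕ
  threshold′ i r with p ≤? i
  ... | yes _ = i + r + p
  ... | no  _ = lowThreshold r

  threshold-high : ∀ i r → p ≤ i → threshold′ i r ≡ i + r + p
  threshold-high i r p≤i with p ≤? i
  ... | yes _   = refl
  ... | no  p≰i = ⊥-elim (p≰i p≤i)

  threshold-low : ∀ i r → i < p → threshold′ i r ≡ lowThreshold r
  threshold-low i r i<p with p ≤? i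
  ... | yes p≤i = ⊥-elim (<-irrefl refl (<-≤-trans i<p p≤i))
  ... | no  _   = refl

  threshold : ℕ → ℕ
  threshold M = threshold′ (M / 2) (M % 2)

  threshold-parity : ∀ r i → r < 2 → threshold (r + i * 2) ≡ threshold′ i r
  threshold-parity r i r<2 = cong₂ threshold′ (m<n⇒[m+kn]/n≡k r i 2 r<2) (m<n⇒[m+kn]%n≡m r i 2 r<2)

  half-moment+a : ∀ r i → (r + i * 2 + a) / 2 ≡ (r + s) / 2 + (i + h)
  half-moment+a r i = trans (cong (_/ 2) (trans (cong (r + i * 2 +_) a≡s+h*2) (rearrange r i s h)))
                            ([m+kn]/n≡m/n+k (r + s) (i + h) 2)
    where
    rearrange : ∀ r i s h → r + i * 2 + (s + h * 2) ≡ r + s + (i + h) * 2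
    rearrange = solve-∀

  floor+ceil-half : ∀ r → r < 2 → (r + s) / 2 + ⌈ r + s /2⌉ ≡ r + s
  floor+ceil-half r r<2 = go r s r<2 s<2
    where
    go : ∀ r s → r < 2 → s < 2 → (r + s) / 2 + ⌈ r + s /2⌉ ≡ r + s
    go 0 0 _ _ = refl
    go 0 1 _ _ = refl
    go 1 0 _ _ = refl
    go 1 1 _ _ = refl
    go 0 (suc (suc _)) _ (s≤s (s≤s ()))
    go 1 (suc (suc _)) _ (s≤s (s≤s ()))
    go (suc (suc _)) _ (s≤s (s≤s ())) _

  ceil-half≤1 : ∀ r → r < 2 → ⌈ r + s /2⌉ ≤ 1
  ceil-half≤1 r r<2 = ⌈n/2⌉-mono (+-mono-≤ (s≤s⁻¹ r<2) (s≤s⁻¹ s<2))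

  ⌈s/2⌉≡s : ⌈ s /2⌉ ≡ s
  ⌈s/2⌉≡s = go s s<2
    where
    go : ∀ s → s < 2 → ⌈ s /2⌉ ≡ s
    go 0 _ = refl
    go 1 _ = refl
    go (suc (suc _)) (s≤s (s≤s ()))

  ⌈1+s/2⌉≡1 : ⌈ 1 + s /2⌉ ≡ 1
  ⌈1+s/2⌉≡1 = cong suc (n≤0⇒n≡0 (⌊n/2⌋-mono (s≤s⁻¹ s<2)))

  pred-p+ceil-half≤p : ∀ r → r < 2 → 1 ≤ p → p ∸ 1 + ⌈ r + s /2⌉ ≤ p
  pred-p+ceil-half≤p r r<2 1≤p = ≤-trans (+-monoʳ-≤ (p ∸ 1) (ceil-half≤1 r r<2)) (≤-reflexive (m∸n+n≡m 1≤p))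

  fibreSizes-below-high : ∀ r i K → r < 2 → p ≤ i → K < i + r + p →
    fibreSize K (r + i * 2) + fibreSize (K ∸ d) (r + i * 2 + a) ≤ p
  fibreSizes-below-high r i K r<2 p≤i K<i+r+p = ≤-trans (+-mono-≤ first second) (≤-reflexive (+-identityʳ p))
    where
    K≤i+h : K ≤ i + h
    K≤i+h = s≤s⁻¹ (begin
      suc K            ≤⟨ K<i+r+p ⟩
      i + r + p        ≤⟨ +-monoˡ-≤ p (+-monoʳ-≤ i (s≤s⁻¹ r<2)) ⟩
      i + 1 + p        ≡⟨ cong (_+ p) (+-comm i 1) ⟩
      suc (i + p)      ≤⟨ s≤s (+-monoʳ-≤ i p≤a/2) ⟩
      suc (i + h)      ∎)
      where open ≤-Reasoning
    K∸d<i+h : K ∸ d < i + h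
    K∸d<i+h = m<n+o⇒m∸n<o K d {{>-nonZero (≤-trans 1≤h (m≤n+m h i))}} (s≤s (≤-trans K≤i+h (m≤n+m _ d₀)))
    first : fibreSize K (r + i * 2) ≤ p
    first = fibreSize-≤ K (r + i * 2) p (begin
      suc ((r + i * 2) / 2) + K   ≡⟨ cong (λ z → suc z + K) (m<n⇒[m+kn]/n≡k r i 2 r<2) ⟩
      suc i + K                   ≡⟨ +-suc i K ⟨
      i + suc K                   ≤⟨ +-monoʳ-≤ i K<i+r+p ⟩
      i + (i + r + p)             ≡⟨ rearrange i r p ⟩
      p + (r + i * 2)             ∎)
      where
      open ≤-Reasoning
      rearrange : ∀ i r p → i + (i + r + p) ≡ p + (r + i * 2)
      rearrange = solve-∀
    second : fibreSize (K ∸ d) (r + i * 2 + a) ≤ 0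
    second = fibreSize-≤ (K ∸ d) (r + i * 2 + a) 0 (begin
      suc ((r + i * 2 + a) / 2) + (K ∸ d)     ≡⟨ cong (λ z → suc z + (K ∸ d)) (half-moment+a r i) ⟩
      suc ((r + s) / 2 + (i + h)) + (K ∸ d)   ≡⟨ +-suc _ (K ∸ d) ⟨
      (r + s) / 2 + (i + h) + suc (K ∸ d)     ≤⟨ +-monoʳ-≤ _ K∸d<i+h ⟩
      (r + s) / 2 + (i + h) + (i + h)         ≤⟨ +-monoˡ-≤ (i + h) (+-monoˡ-≤ (i + h) (m/n≤m (r + s) 2)) ⟩
      r + s + (i + h) + (i + h)               ≡⟨ rearrange r i s h ⟩
      r + i * 2 + (s + h * 2)                 ≡⟨ cong (r + i * 2 +_) a≡s+h*2 ⟨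
      0 + (r + i * 2 + a)                     ∎)
      where
      open ≤-Reasoning
      rearrange : ∀ r i s h → r + s + (i + h) + (i + h) ≡ r + i * 2 + (s + h * 2)
      rearrange = solve-∀

  fibreSizes-below-low : ∀ r i K → r < 2 → i < p → K < lowThreshold r →
    fibreSize K (r + i * 2) + fibreSize (K ∸ d) (r + i * 2 + a) ≤ p
  fibreSizes-below-low r i K r<2 i<p K<T = ≤-trans (+-mono-≤ first second) (≤-reflexive (m+[n∸m]≡n i<p))
    where
    B = ⌈ r + s /2⌉
    w = p ∸ suc i
    first : fibreSize K (r + i * 2) ≤ suc i
    first = ≤-trans (m∸n≤m _ (r + i * 2 ∸ K)) (≤-reflexive (cong suc (m<n⇒[m+kn]/n≡k r i 2 r<2)))
    K∸d≤ : suc (K ∸ d) ≤ h + (p ∸ 1) + B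
    K∸d≤ = m<n+o⇒m∸n<o K d {{>-nonZero (≤-trans 1≤h (≤-trans (m≤m+n h (p ∸ 1)) (m≤m+n _ B)))}}
             (<-≤-trans K<T (≤-reflexive (rearrange h d (p ∸ 1) B)))
      where
      rearrange : ∀ h d q B → h + d + q + B ≡ d + (h + q + B)
      rearrange = solve-∀
    second : fibreSize (K ∸ d) (r + i * 2 + a) ≤ w
    second = fibreSize-≤ (K ∸ d) (r + i * 2 + a) w (begin
      suc ((r + i * 2 + a) / 2) + (K ∸ d)         ≡⟨ cong (λ z → suc z + (K ∸ d)) (half-moment+a r i) ⟩
      suc ((r + s) / 2 + (i + h)) + (K ∸ d)       ≡⟨ +-suc _ (K ∸ d) ⟨
      (r + s) / 2 + (i + h) + suc (K ∸ d)         ≤⟨ +-monoʳ-≤ _ K∸d≤ ⟩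
      (r + s) / 2 + (i + h) + (h + (p ∸ 1) + B)   ≡⟨ cong (λ z → (r + s) / 2 + (i + h) + (h + (z ∸ 1) + B)) (m+[n∸m]≡n i<p) ⟨
      (r + s) / 2 + (i + h) + (h + (i + w) + B)   ≡⟨ rearrange ((r + s) / 2) B i h w ⟩
      (r + s) / 2 + B + (i + h) * 2 + w           ≡⟨ cong (λ z → z + (i + h) * 2 + w) (floor+ceil-half r r<2) ⟩
      r + s + (i + h) * 2 + w                     ≡⟨ rearrange′ r s i h w ⟩
      w + (r + i * 2 + (s + h * 2))               ≡⟨ cong (λ z → w + (r + i * 2 + z)) a≡s+h*2 ⟨
      w + (r + i * 2 + a)                         ∎)
      where
      open ≤-Reasoning
      rearrange : ∀ F B i h w → F + (i + h) + (h + (i + w) + B) ≡ F + B + (i + h) * 2 + w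
      rearrange = solve-∀
      rearrange′ : ∀ r s i h w → r + s + (i + h) * 2 + w ≡ w + (r + i * 2 + (s + h * 2))
      rearrange′ = solve-∀

  fibreSizes-below-threshold : ∀ r i K → r < 2 → K < threshold′ i r →
    fibreSize K (r + i * 2) + fibreSize (K ∸ d) (r + i * 2 + a) ≤ p
  fibreSizes-below-threshold r i K r<2 K<T with i <? p
  ... | no  i≮p = fibreSizes-below-high r i K r<2 (≮⇒≥ i≮p) (<-≤-trans K<T (≤-reflexive (threshold-high i r (≮⇒≥ i≮p))))
  ... | yes i<p = fibreSizes-below-low r i K r<2 i<p (<-≤-trans K<T (≤-reflexive (threshold-low i r i<p)))

  by-parity : (P : ℕ → Set) → (∀ r i → r < 2 → P (r + i * 2)) → ∀ M → P M
  by-parity P f M = subst P (sym (m≡m%n+[m/n]*n M 2)) (f (M % 2) (M / 2) (m%n<n M 2))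

  half-moment≤h : ∀ r i → r < 2 → r + i * 2 < a → i + r ≤ h
  half-moment≤h r i r<2 M<a = s≤s⁻¹ (*-cancelʳ-< 2 (i + r) (suc h) (begin-strict
    (i + r) * 2         ≡⟨ rearrange i r ⟩
    r + i * 2 + r       <⟨ +-mono-<-≤ M<a (s≤s⁻¹ r<2) ⟩
    a + 1               ≡⟨ cong (_+ 1) a≡s+h*2 ⟩
    s + h * 2 + 1       ≤⟨ +-monoˡ-≤ 1 (+-monoˡ-≤ (h * 2) (s≤s⁻¹ s<2)) ⟩
    1 + h * 2 + 1       ≡⟨ rearrange′ h ⟩
    suc h * 2           ∎))
    where
    open ≤-Reasoning
    rearrange : ∀ i r → (i + r) * 2 ≡ r + i * 2 + r
    rearrange = solve-∀
    rearrange′ : ∀ h → 1 + h * 2 + 1 ≡ suc h * 2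
    rearrange′ = solve-∀

  h+h≤a : h + h ≤ a
  h+h≤a = ≤-trans (≤-reflexive (double h)) (≤-trans (m≤n+m (h * 2) s) (≤-reflexive (sym a≡s+h*2)))
    where
    double : ∀ h → h + h ≡ h * 2
    double = solve-∀

  threshold′≤a+d : ∀ r i → r < 2 → r + i * 2 < a → threshold′ i r ≤ a + d
  threshold′≤a+d r i r<2 M<a with i <? p
  ... | no i≮p = begin
    threshold′ i r              ≡⟨ threshold-high i r (≮⇒≥ i≮p) ⟩
    i + r + p                   ≤⟨ +-mono-≤ (half-moment≤h r i r<2 M<a) p≤a/2 ⟩
    h + h                       ≤⟨ h+h≤a ⟩
    a                           ≤⟨ m≤m+n a d ⟩
    a + d                       ∎
    where open ≤-Reasoning
  ... | yes i<p = begin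
    threshold′ i r              ≡⟨ threshold-low i r i<p ⟩
    h + d + (p ∸ 1) + ⌈ r + s /2⌉   ≡⟨ +-assoc (h + d) (p ∸ 1) _ ⟩
    h + d + (p ∸ 1 + ⌈ r + s /2⌉)   ≤⟨ +-monoʳ-≤ (h + d) (≤-trans (pred-p+ceil-half≤p r r<2 (≤-trans (s≤s z≤n) i<p)) p≤a/2) ⟩
    h + d + h                   ≡⟨ rearrange h d ⟩
    h + h + d                   ≤⟨ +-monoˡ-≤ d h+h≤a ⟩
    a + d                       ∎
    where
    open ≤-Reasoning
    rearrange : ∀ h d → h + d + h ≡ h + h + d
    rearrange = solve-∀

  repCount-below-threshold : ∀ M K → M < a → K < threshold M → rc (a * K + d * M) ≤ p
  repCount-below-threshold = by-parity (λ M → ∀ K → M < a → K < threshold M → rc (a * K + d * M) ≤ p) below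
    where
    below : ∀ r i → r < 2 → ∀ K → r + i * 2 < a → K < threshold (r + i * 2) → rc (a * K + d * (r + i * 2)) ≤ p
    below r i r<2 K M<a K<T = begin
      rc (a * K + d * M)                   ≤⟨ repCount-≤ (fibre K M ++ fibre (K ∸ d) (M + a))
                                                 (solutions⊆fibres K M M<a (<-≤-trans K<T′ (threshold′≤a+d r i r<2 M<a))) ⟩
      length (fibre K M ++ fibre (K ∸ d) (M + a))  ≡⟨ length-++ (fibre K M) ⟩
      length (fibre K M) + length (fibre (K ∸ d) (M + a))  ≡⟨ cong₂ _+_ (fibre-length K M) (fibre-length (K ∸ d) (M + a)) ⟩
      fibreSize K M + fibreSize (K ∸ d) (M + a)  ≤⟨ fibreSizes-below-threshold r i K r<2 K<T′ ⟩
      p                                    ∎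
      where
      open ≤-Reasoning
      M = r + i * 2
      K<T′ : K < threshold′ i r
      K<T′ = <-≤-trans K<T (≤-reflexive (threshold-parity r i r<2))

  repCount-below-residue : ∀ n M J → M < a → n + a * suc J ≡ d * M → rc n ≡ 0
  repCount-below-residue n M J M<a eq = n≤0⇒n≡0 (repCount-≤ [] no-solution)
    where
    no-solution : ∀ t → Solves a (a + d) (a + 2 * d) n t → t ∈ []
    no-solution (x₁ , x₂ , x₃) sol = ⊥-elim (weight-not-below-residue (x₁ + x₂ + x₃) (x₂ + 2 * x₃) M J
      (trans (cong (_+ a * suc J) (trans (sym (progression-weight a d x₁ x₂ x₃)) sol)) eq) M<a)

  private
    lowThreshold≡ : ∀ r → lowThreshold r ≡ h + (p ∸ 1) + ⌈ r + s /2⌉ + d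
    lowThreshold≡ r = rearrange h d (p ∸ 1) ⌈ r + s /2⌉
      where
      rearrange : ∀ h d q B → h + d + q + B ≡ h + q + B + d
      rearrange = solve-∀

  repCount-at-high-threshold : ∀ r i → r < 2 → p ≤ i → p < rc (a * (i + r + p) + d * (r + i * 2))
  repCount-at-high-threshold r i r<2 p≤i = begin
    suc p                          ≡⟨ fibreSize≡ ⟨
    fibreSize T M                  ≡⟨ fibre-length T M ⟨
    length (fibre T M)             ≤⟨ repCount-≥ (fibre T M) (fibre-Unique T M) (fibre⊆solutions a d T M) ⟩
    rc (a * T + d * M)             ∎
    where
    open ≤-Reasoning
    M = r + i * 2
    T = i + r + p
    q = i ∸ p
    i≡p+q : i ≡ p + q
    i≡p+q = sym (m+[n∸m]≡n p≤i)
    M≡T+q : M ≡ T + q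
    M≡T+q = begin-equality
      r + i * 2                ≡⟨ cong (λ z → r + z * 2) i≡p+q ⟩
      r + (p + q) * 2          ≡⟨ rearrange r p q ⟩
      (p + q) + r + p + q      ≡⟨ cong (λ z → z + r + p + q) i≡p+q ⟨
      T + q                    ∎
      where
      rearrange : ∀ r p q → r + (p + q) * 2 ≡ (p + q) + r + p + q
      rearrange = solve-∀
    fibreSize≡ : fibreSize T M ≡ suc p
    fibreSize≡ = begin-equality
      suc (M / 2) ∸ (M ∸ T)        ≡⟨ cong₂ (λ x y → suc x ∸ y) (m<n⇒[m+kn]/n≡k r i 2 r<2) (trans (cong (_∸ T) M≡T+q) (m+n∸m≡n T q)) ⟩
      suc i ∸ q                    ≡⟨ cong (λ z → suc z ∸ q) i≡p+q ⟩
      suc (p + q) ∸ q              ≡⟨ m+n∸n≡m (suc p) q ⟩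
      suc p                        ∎

  fibreSize-at-low-threshold : ∀ r i → r < 2 → i < p → fibreSize (lowThreshold r) (r + i * 2) ≡ suc i
  fibreSize-at-low-threshold r i r<2 i<p = cong₂ (λ x y → suc x ∸ y) (m<n⇒[m+kn]/n≡k r i 2 r<2) (m≤n⇒m∸n≡0 M≤T)
    where
    open ≤-Reasoning
    M≤T : r + i * 2 ≤ lowThreshold r
    M≤T = begin
      r + i * 2                        ≤⟨ +-monoˡ-≤ (i * 2) (s≤s⁻¹ r<2) ⟩
      1 + i * 2                        ≡⟨ rearrange i ⟩
      suc i + i                        ≤⟨ +-mono-≤ (≤-trans i<p p≤a/2) (≤-pred (≤-trans i<p (≤-reflexive (sym (suc-pred p {{>-nonZero (≤-trans (s≤s z≤n) i<p)}}))))) ⟩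
      h + (p ∸ 1)                      ≤⟨ m≤m+n (h + (p ∸ 1)) _ ⟩
      h + (p ∸ 1) + ⌈ r + s /2⌉        ≤⟨ m≤m+n _ d ⟩
      h + (p ∸ 1) + ⌈ r + s /2⌉ + d    ≡⟨ lowThreshold≡ r ⟨
      lowThreshold r                   ∎
      where
      rearrange : ∀ i → 1 + i * 2 ≡ suc i + i
      rearrange = solve-∀

  fibreSize-shifted-at-low-threshold : ∀ r i → r < 2 → i < p →
    fibreSize (lowThreshold r ∸ d) (r + i * 2 + a) ≡ suc (p ∸ suc i)
  fibreSize-shifted-at-low-threshold r i r<2 i<p = begin
    suc ((M + a) / 2) ∸ (M + a ∸ (lowThreshold r ∸ d))  ≡⟨ cong₂ (λ x y → suc x ∸ (M + a ∸ y)) (half-moment+a r i) T∸d≡Y ⟩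
    suc (F + (i + h)) ∸ (M + a ∸ Y)             ≡⟨ cong₂ (λ x y → suc (F + (i + x)) ∸ y) (sym h≡) (trans (cong (_∸ Y) M+a≡) (m+n∸m≡n Y excess)) ⟩
    suc (F + (i + (suc i + w + v))) ∸ excess    ≡⟨ cong (_∸ excess) (rearrange F i w v) ⟩
    suc w + excess ∸ excess                     ≡⟨ m+n∸n≡m (suc w) excess ⟩
    suc w                                       ∎
    where
    open ≡-Reasoning
    M = r + i * 2
    F = (r + s) / 2
    B = ⌈ r + s /2⌉
    w = p ∸ suc i
    v = h ∸ p
    h≡ : suc i + w + v ≡ h
    h≡ = trans (cong (_+ v) (m+[n∸m]≡n i<p)) (m+[n∸m]≡n p≤a/2)
    pred-p≡ : p ∸ 1 ≡ i + w
    pred-p≡ = cong (_∸ 1) (sym (m+[n∸m]≡n i<p))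
    Y = h + (p ∸ 1) + B
    T∸d≡Y : lowThreshold r ∸ d ≡ Y
    T∸d≡Y = trans (cong (_∸ d) (lowThreshold≡ r)) (m+n∸n≡m Y d)
    excess = F + (i + suc i) + v
    M+a≡ : M + a ≡ Y + excess
    M+a≡ = begin
      r + i * 2 + a                                  ≡⟨ cong (r + i * 2 +_) a≡s+h*2 ⟩
      r + i * 2 + (s + h * 2)                        ≡⟨ cong (λ z → r + i * 2 + (s + z * 2)) h≡ ⟨
      r + i * 2 + (s + (suc i + w + v) * 2)          ≡⟨ rearrange r s i w v ⟩
      r + s + (suc i + w + v + (i + w) + (i + suc i) + v)   ≡⟨ cong (_+ (suc i + w + v + (i + w) + (i + suc i) + v)) (floor+ceil-half r r<2) ⟨
      F + B + (suc i + w + v + (i + w) + (i + suc i) + v)   ≡⟨ rearrange′ F B i w v ⟩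
      suc i + w + v + (i + w) + B + excess           ≡⟨ cong₂ (λ x y → x + y + B + excess) h≡ (sym pred-p≡) ⟩
      Y + excess                                     ∎
      where
      rearrange : ∀ r s i w v → r + i * 2 + (s + (suc i + w + v) * 2) ≡ r + s + (suc i + w + v + (i + w) + (i + suc i) + v)
      rearrange = solve-∀
      rearrange′ : ∀ F B i w v → F + B + (suc i + w + v + (i + w) + (i + suc i) + v) ≡ suc i + w + v + (i + w) + B + (F + (i + suc i) + v)
      rearrange′ = solve-∀
    rearrange : ∀ F i w v → suc (F + (i + (suc i + w + v))) ≡ suc w + (F + (i + suc i) + v)
    rearrange = solve-∀

  repCount-at-low-threshold : ∀ r i → r < 2 → i < p → p < rc (a * lowThreshold r + d * (r + i * 2))
  repCount-at-low-threshold r i r<2 i<p = begin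
    suc p                                              ≡⟨ cong suc (trans (+-suc i (p ∸ suc i)) (m+[n∸m]≡n i<p)) ⟨
    suc i + suc (p ∸ suc i)                            ≡⟨ cong₂ _+_ (fibreSize-at-low-threshold r i r<2 i<p)
                                                                    (fibreSize-shifted-at-low-threshold r i r<2 i<p) ⟨
    fibreSize T M + fibreSize (T ∸ d) (M + a)          ≡⟨ cong₂ _+_ (fibre-length T M) (fibre-length (T ∸ d) (M + a)) ⟨
    length (fibre T M) + length (fibre (T ∸ d) (M + a))  ≡⟨ length-++ (fibre T M) ⟨
    length (fibre T M ++ fibre (T ∸ d) (M + a))        ≤⟨ repCount-≥ (fibre T M ++ fibre (T ∸ d) (M + a))
                                                            (fibres-Unique T M (T ∸ d) (M + a) M≢M+a) solution ⟩
    rc (a * T + d * M)                                 ∎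
    where
    open ≤-Reasoning
    M = r + i * 2
    T = lowThreshold r
    M≢M+a : M ≢ M + a
    M≢M+a eq = <-irrefl eq (m<m+n M (s≤s z≤n))
    solution : ∀ {t} → t ∈ fibre T M ++ fibre (T ∸ d) (M + a) → Solves a (a + d) (a + 2 * d) (a * T + d * M) t
    solution t∈ with ∈-++⁻ (fibre T M) t∈
    ... | inj₁ t∈₁ = fibre⊆solutions a d T M t∈₁
    ... | inj₂ t∈₂ = shifted-fibre⊆solutions a d T M (subst (d ≤_) (sym (lowThreshold≡ r)) (m≤n+m d _)) t∈₂

  repCount-at-threshold : ∀ M → M < a → p < rc (a * threshold M + d * M)
  repCount-at-threshold = by-parity (λ M → M < a → p < rc (a * threshold M + d * M)) at
    where
    at′ : ∀ r i → r < 2 → p < rc (a * threshold′ i r + d * (r + i * 2))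
    at′ r i r<2 with i <? p
    ... | no  i≮p = subst (λ T → p < rc (a * T + d * (r + i * 2))) (sym (threshold-high i r (≮⇒≥ i≮p)))
                      (repCount-at-high-threshold r i r<2 (≮⇒≥ i≮p))
    ... | yes i<p = subst (λ T → p < rc (a * T + d * (r + i * 2))) (sym (threshold-low i r i<p))
                      (repCount-at-low-threshold r i r<2 i<p)
    at : ∀ r i → r < 2 → r + i * 2 < a → p < rc (a * threshold (r + i * 2) + d * (r + i * 2))
    at r i r<2 _ = subst (λ T → p < rc (a * T + d * (r + i * 2))) (sym (threshold-parity r i r<2)) (at′ r i r<2)

  repCount-above-threshold : ∀ M K → M < a → threshold M ≤ K → p < rc (a * K + d * M)
  repCount-above-threshold M K M<a T≤K = begin-strict
    p                                            <⟨ repCount-at-threshold M M<a ⟩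
    rc (a * threshold M + d * M)                 ≤⟨ repCount-mono-+a* (K ∸ threshold M) _ ⟩
    rc (a * (K ∸ threshold M) + (a * threshold M + d * M))  ≡⟨ cong rc (rearrange a d (K ∸ threshold M) (threshold M) M) ⟩
    rc (a * (K ∸ threshold M + threshold M) + d * M)        ≡⟨ cong (λ k → rc (a * k + d * M)) (m∸n+n≡m T≤K) ⟩
    rc (a * K + d * M)                           ∎
    where
    open ≤-Reasoning
    rearrange : ∀ a d x T M → a * x + (a * T + d * M) ≡ a * (x + T) + d * M
    rearrange = solve-∀

  weight-decomposition : ∀ n → ∃ λ M → M < a × ((∃ λ K → n ≡ a * K + d * M) ⊎ (∃ λ J → n + a * suc J ≡ d * M))
  weight-decomposition n with residue-representative n
  ... | M , M<a , dM≡n = M , M<a , above-or-below n (d * M) a dM≡n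

  -- The Frobenius number g_p

  frobenius : ℕ
  frobenius = (a + 2 * d) * p + ((a ∸ 2) / 2) * a + (a ∸ 1) * d

  frobenius+a≡ : frobenius + a ≡ (a + 2 * d) * p + a * h + a₁ * d
  frobenius+a≡ = trans (rearrange a d p ((a ∸ 2) / 2) a₁) (cong (λ z → (a + 2 * d) * p + a * z + a₁ * d) (sym h≡))
    where
    rearrange : ∀ a d p H a₁ → (a + 2 * d) * p + H * a + a₁ * d + a ≡ (a + 2 * d) * p + a * suc H + a₁ * d
    rearrange = solve-∀
    h≡ : h ≡ suc ((a ∸ 2) / 2)
    h≡ = trans (cong (_/ 2) (+-comm 2 (suc a₀))) (trans ([m+kn]/n≡m/n+k (suc a₀) 1 2) (+-comm (suc a₀ / 2) 1))

  weight-at-high-threshold≤ : ∀ r i → r < 2 → r + i * 2 < a → p ≤ i →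
    a * (i + r + p) + d * (r + i * 2) ≤ (a + 2 * d) * p + a * h + a₁ * d
  weight-at-high-threshold≤ r i r<2 M<a p≤i = begin
    a * (i + r + p) + d * (r + i * 2)      ≤⟨ +-mono-≤ (*-monoʳ-≤ a (+-monoˡ-≤ p (half-moment≤h r i r<2 M<a))) (*-monoʳ-≤ d (s≤s⁻¹ M<a)) ⟩
    a * (h + p) + d * a₁                   ≤⟨ +≡⇒≤ (2 * d * p) (rearrange a d h p a₁) ⟩
    (a + 2 * d) * p + a * h + a₁ * d       ∎
    where
    open ≤-Reasoning
    rearrange : ∀ a d h p a₁ → a * (h + p) + d * a₁ + 2 * d * p ≡ (a + 2 * d) * p + a * h + a₁ * d
    rearrange = solve-∀

  weight-at-low-threshold≤ : ∀ r i → r < 2 → i < p →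
    a * lowThreshold r + d * (r + i * 2) ≤ (a + 2 * d) * p + a * h + a₁ * d
  weight-at-low-threshold≤ r i r<2 i<p = begin
    a * (h + d + (p ∸ 1) + ⌈ r + s /2⌉) + d * (r + i * 2)
                                           ≡⟨ cong (λ T → a * T + d * (r + i * 2)) (+-assoc (h + d) (p ∸ 1) _) ⟩
    a * (h + d + (p ∸ 1 + ⌈ r + s /2⌉)) + d * (r + i * 2)
                                           ≤⟨ +-mono-≤ (*-monoʳ-≤ a (+-monoʳ-≤ (h + d) (pred-p+ceil-half≤p r r<2 (≤-trans (s≤s z≤n) i<p))))
                                                       (*-monoʳ-≤ d (+-monoˡ-≤ (i * 2) (s≤s⁻¹ r<2))) ⟩
    a * (h + d + p) + d * (1 + i * 2)      ≡⟨ cong (λ z → a * (h + d + z) + d * (1 + i * 2)) p≡ ⟨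
    a * (h + d + (suc i + w)) + d * (1 + i * 2)
                                           ≤⟨ +≡⇒≤ (2 * d * w) (rearrange a₁ d h i w) ⟩
    (a + 2 * d) * (suc i + w) + a * h + a₁ * d  ≡⟨ cong (λ z → (a + 2 * d) * z + a * h + a₁ * d) p≡ ⟩
    (a + 2 * d) * p + a * h + a₁ * d       ∎
    where
    open ≤-Reasoning
    w = p ∸ suc i
    p≡ : suc i + w ≡ p
    p≡ = m+[n∸m]≡n i<p
    rearrange : ∀ a₁ d h i w → suc a₁ * (h + d + (suc i + w)) + d * (1 + i * 2) + 2 * d * w
                               ≡ (suc a₁ + 2 * d) * (suc i + w) + suc a₁ * h + a₁ * d
    rearrange = solve-∀

  weight-at-threshold≤ : ∀ M → M < a → a * threshold M + d * M ≤ frobenius + a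
  weight-at-threshold≤ = by-parity (λ M → M < a → a * threshold M + d * M ≤ frobenius + a) bound
    where
    bound′ : ∀ r i → r < 2 → r + i * 2 < a → a * threshold′ i r + d * (r + i * 2) ≤ (a + 2 * d) * p + a * h + a₁ * d
    bound′ r i r<2 M<a with i <? p
    ... | no  i≮p = subst (λ T → a * T + d * (r + i * 2) ≤ _) (sym (threshold-high i r (≮⇒≥ i≮p)))
                      (weight-at-high-threshold≤ r i r<2 M<a (≮⇒≥ i≮p))
    ... | yes i<p = subst (λ T → a * T + d * (r + i * 2) ≤ _) (sym (threshold-low i r i<p))
                      (weight-at-low-threshold≤ r i r<2 i<p)
    bound : ∀ r i → r < 2 → r + i * 2 < a → a * threshold (r + i * 2) + d * (r + i * 2) ≤ frobenius + a
    bound r i r<2 M<a = subst₂ (λ T G → a * T + d * (r + i * 2) ≤ G) (sym (threshold-parity r i r<2)) (sym frobenius+a≡)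
                          (bound′ r i r<2 M<a)

  AttainsFrobenius : ℕ → Set
  AttainsFrobenius M = M < a × 1 ≤ threshold M × a * threshold M + d * M ≡ frobenius + a

  last-moment-attains : 0 ≡ p → AttainsFrobenius a₁
  last-moment-attains 0≡p = ≤-refl , 1≤T , trans weight≡ (sym frobenius+a≡)
    where
    r = a₁ % 2
    i = a₁ / 2
    r<2 = m%n<n a₁ 2
    a₁≡ : r + i * 2 ≡ a₁
    a₁≡ = sym (m≡m%n+[m/n]*n a₁ 2)
    h≤i+r : h ≤ i + r
    h≤i+r = s≤s⁻¹ (*-cancelʳ-< 2 h (suc (i + r)) (s≤s (begin
      h * 2              ≤⟨ m≤n+m (h * 2) s ⟩
      s + h * 2          ≡⟨ a≡s+h*2 ⟨
      a                  ≡⟨ cong suc a₁≡ ⟨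
      suc (r + i * 2)    ≤⟨ s≤s (+≡⇒≤ r (rearrange i r)) ⟩
      suc ((i + r) * 2)  ∎)))
      where
      open ≤-Reasoning
      rearrange : ∀ i r → r + i * 2 + r ≡ (i + r) * 2
      rearrange = solve-∀
    T≡h : threshold a₁ ≡ h + 0
    T≡h = begin-equality
      threshold a₁                  ≡⟨ cong threshold a₁≡ ⟨
      threshold (r + i * 2)         ≡⟨ threshold-parity r i r<2 ⟩
      threshold′ i r                ≡⟨ threshold-high i r (subst (_≤ i) 0≡p z≤n) ⟩
      i + r + p                     ≡⟨ cong₂ _+_ (≤-antisym (half-moment≤h r i r<2 (subst (_< a) (sym a₁≡) ≤-refl)) h≤i+r) (sym 0≡p) ⟩
      h + 0                         ∎
      where open ≤-Reasoning
    1≤T : 1 ≤ threshold a₁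
    1≤T = subst (1 ≤_) (sym T≡h) (≤-trans 1≤h (m≤m+n h 0))
    weight≡ : a * threshold a₁ + d * a₁ ≡ (a + 2 * d) * p + a * h + a₁ * d
    weight≡ = trans (cong (λ T → a * T + d * a₁) T≡h) (trans (rearrange a d h a₁) (cong (λ z → (a + 2 * d) * z + a * h + a₁ * d) 0≡p))
      where
      rearrange : ∀ a d h a₁ → a * (h + 0) + d * a₁ ≡ (a + 2 * d) * 0 + a * h + a₁ * d
      rearrange = solve-∀

  odd-moment-attains : ∀ q → suc q ≡ p → AttainsFrobenius (1 + q * 2)
  odd-moment-attains q 1+q≡p = M<a , 1≤T , trans weight≡ (sym frobenius+a≡)
    where
    M = 1 + q * 2
    T≡ : threshold M ≡ h + d + q + 1
    T≡ = trans (threshold-parity 1 q (s≤s (s≤s z≤n)))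
           (trans (threshold-low q 1 (≤-reflexive 1+q≡p)) (cong₂ (λ z c → h + d + (z ∸ 1) + c) (sym 1+q≡p) ⌈1+s/2⌉≡1))
    M<a : M < a
    M<a = begin-strict
      1 + q * 2          <⟨ ≤-refl ⟩
      suc q * 2          ≤⟨ *-monoˡ-≤ 2 (≤-trans (≤-reflexive 1+q≡p) p≤a/2) ⟩
      h * 2              ≤⟨ m≤n+m (h * 2) s ⟩
      s + h * 2          ≡⟨ a≡s+h*2 ⟨
      a                  ∎
      where open ≤-Reasoning
    1≤T : 1 ≤ threshold M
    1≤T = subst (1 ≤_) (sym T≡) (m≤n+m 1 (h + d + q))
    weight≡ : a * threshold M + d * M ≡ (a + 2 * d) * p + a * h + a₁ * d
    weight≡ = trans (cong (λ T → a * T + d * M) T≡) (trans (rearrange a₁ d h q) (cong (λ z → (a + 2 * d) * z + a * h + a₁ * d) 1+q≡p))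
      where
      rearrange : ∀ a₁ d h q → suc a₁ * (h + d + q + 1) + d * (1 + q * 2) ≡ (suc a₁ + 2 * d) * suc q + suc a₁ * h + a₁ * d
      rearrange = solve-∀

  frobenius-witness : ∃ AttainsFrobenius
  frobenius-witness = witness p refl
    where
    witness : ∀ q → q ≡ p → ∃ AttainsFrobenius
    witness zero    0≡p   = a₁ , last-moment-attains 0≡p
    witness (suc q) 1+q≡p = 1 + q * 2 , odd-moment-attains q 1+q≡p

  frobenius-repCount≤ : rc frobenius ≤ p
  frobenius-repCount≤ with frobenius-witness
  ... | M , M<a , 1≤T , eq = subst (λ n → rc n ≤ p) weight≡ (repCount-below-threshold M (threshold M ∸ 1) M<a ∸1<T)
    where
    T∸1+1 : threshold M ∸ 1 + 1 ≡ threshold M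
    T∸1+1 = m∸n+n≡m 1≤T
    ∸1<T : threshold M ∸ 1 < threshold M
    ∸1<T = ≤-reflexive (trans (+-comm 1 _) T∸1+1)
    weight≡ : a * (threshold M ∸ 1) + d * M ≡ frobenius
    weight≡ = +-cancelʳ-≡ a _ _ (begin-equality
      a * (threshold M ∸ 1) + d * M + a       ≡⟨ rearrange a (threshold M ∸ 1) (d * M) ⟩
      a * (threshold M ∸ 1 + 1) + d * M       ≡⟨ cong (λ T → a * T + d * M) T∸1+1 ⟩
      a * threshold M + d * M                 ≡⟨ eq ⟩
      frobenius + a                           ∎)
      where
      open ≤-Reasoning
      rearrange : ∀ a x y → a * x + y + a ≡ a * (x + 1) + y
      rearrange = solve-∀

  frobenius-maximal : ∀ n → frobenius < n → p < rc n
  frobenius-maximal n frobenius<n with weight-decomposition n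
  ... | M , M<a , inj₁ (K , n≡) with threshold M ≤? K
  ...   | yes T≤K = subst (λ n → p < rc n) (sym n≡) (repCount-above-threshold M K M<a T≤K)
  ...   | no  T≰K = ⊥-elim (<-irrefl refl (<-≤-trans frobenius<n (+-cancelʳ-≤ a n frobenius (begin
    n + a                       ≡⟨ cong (_+ a) n≡ ⟩
    a * K + d * M + a           ≡⟨ rearrange a K (d * M) ⟩
    a * suc K + d * M           ≤⟨ +-monoˡ-≤ (d * M) (*-monoʳ-≤ a (≰⇒> T≰K)) ⟩
    a * threshold M + d * M     ≤⟨ weight-at-threshold≤ M M<a ⟩
    frobenius + a               ∎))))
    where
    open ≤-Reasoning
    rearrange : ∀ a x y → a * x + y + a ≡ a * suc x + y
    rearrange = solve-∀
  frobenius-maximal n frobenius<n | M , M<a , inj₂ (J , n+aJ≡dM) = ⊥-elim (<-irrefl refl (<-≤-trans frobenius<n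
    (+-cancelʳ-≤ a n frobenius (begin
    n + a                       ≤⟨ +-monoʳ-≤ n (m≤m*n a (suc J)) ⟩
    n + a * suc J               ≡⟨ n+aJ≡dM ⟩
    d * M                       ≤⟨ m≤n+m (d * M) (a * threshold M) ⟩
    a * threshold M + d * M     ≤⟨ weight-at-threshold≤ M M<a ⟩
    frobenius + a               ∎))))
    where open ≤-Reasoning

  -- The genus n_p

  -- Within the residue class of d M the elements with at most p representations are
  -- exactly the a K + d M with K < threshold M together with the d M - a j (j ≥ 1).
  columnHeight : ℕ → ℕ
  columnHeight M = threshold M + d * M / a

  residueColumn : ℕ → List ℕ
  residueColumn M = map (λ j → (d * M) % a + j * a) (upTo (columnHeight M))

  fewRepresentations : List ℕ
  fewRepresentations = concatMap residueColumn (upTo a)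

  private
    ∈-residueColumn⁻ : ∀ M {n} → n ∈ residueColumn M → n % a ≡ (d * M) % a
    ∈-residueColumn⁻ M n∈ with ∈-map⁻ _ n∈
    ... | j , _ , refl = trans ([m+kn]%n≡m%n ((d * M) % a) j a) (m%n%n≡m%n (d * M) a)

    ∈-fewRepresentations⁺′ : ∀ n M j → M < a → j < columnHeight M → n ≡ (d * M) % a + j * a → n ∈ fewRepresentations
    ∈-fewRepresentations⁺′ n M j M<a j<H n≡ =
      ∈-concatMap⁺ residueColumn (lose (∈-upTo⁺ M<a) (subst (_∈ residueColumn M) (sym n≡) (∈-map⁺ _ (∈-upTo⁺ j<H))))

  fewRepresentations-Unique : Unique fewRepresentations
  fewRepresentations-Unique = Unique-concatMap residueColumn (Unique.upTo⁺ a)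
    (λ M → Unique.map⁺ (λ eq → *-cancelʳ-≡ _ _ a (+-cancelˡ-≡ ((d * M) % a) _ _ eq)) (Unique.upTo⁺ (columnHeight M)))
    (λ {M} {M′} M∈ M′∈ n∈ n∈′ → trans (sym (m<n⇒m%n≡m (∈-upTo⁻ M∈)))
      (trans (*-cancelˡ-% M M′ (trans (sym (∈-residueColumn⁻ M n∈)) (∈-residueColumn⁻ M′ n∈′))) (m<n⇒m%n≡m (∈-upTo⁻ M′∈))))

  ∈-fewRepresentations⁺ : ∀ n → rc n ≤ p → n ∈ fewRepresentations
  ∈-fewRepresentations⁺ n rc≤p with weight-decomposition n
  ... | M , M<a , inj₁ (K , n≡) with threshold M ≤? K
  ...   | yes T≤K = ⊥-elim (<-irrefl refl (<-≤-trans (subst (λ n → p < rc n) (sym n≡) (repCount-above-threshold M K M<a T≤K)) rc≤p))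
  ...   | no  T≰K = ∈-fewRepresentations⁺′ n M (K + d * M / a) M<a (+-monoˡ-< (d * M / a) (≰⇒> T≰K)) (begin
    n                                          ≡⟨ n≡ ⟩
    a * K + d * M                              ≡⟨ cong (a * K +_) (m≡m%n+[m/n]*n (d * M) a) ⟩
    a * K + ((d * M) % a + d * M / a * a)      ≡⟨ rearrange a K ((d * M) % a) (d * M / a) ⟩
    (d * M) % a + (K + d * M / a) * a          ∎)
    where
    open ≡-Reasoning
    rearrange : ∀ a K R q → a * K + (R + q * a) ≡ R + (K + q) * a
    rearrange = solve-∀
  ∈-fewRepresentations⁺ n rc≤p | M , M<a , inj₂ (J , n+aJ≡dM) = ∈-fewRepresentations⁺′ n M (n / a) M<a j<H n≡
    where
    residue≡ : (d * M) % a ≡ n % a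
    residue≡ = trans (cong (_% a) (sym n+aJ≡dM)) (trans (cong (λ z → (n + z) % a) (*-comm a (suc J))) ([m+kn]%n≡m%n n (suc J) a))
    n≡ : n ≡ (d * M) % a + n / a * a
    n≡ = trans (m≡m%n+[m/n]*n n a) (cong (_+ n / a * a) (sym residue≡))
    q≡ : d * M / a ≡ n / a + suc J
    q≡ = begin
      d * M / a                           ≡⟨ cong (_/ a) n+aJ≡dM ⟨
      (n + a * suc J) / a                 ≡⟨ cong (λ z → (z + a * suc J) / a) (m≡m%n+[m/n]*n n a) ⟩
      (n % a + n / a * a + a * suc J) / a ≡⟨ cong (_/ a) (rearrange (n % a) (n / a) J a) ⟩
      (n % a + (n / a + suc J) * a) / a   ≡⟨ m<n⇒[m+kn]/n≡k (n % a) (n / a + suc J) a (m%n<n n a) ⟩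
      n / a + suc J                       ∎
      where
      open ≡-Reasoning
      rearrange : ∀ R q J a → R + q * a + a * suc J ≡ R + (q + suc J) * a
      rearrange = solve-∀
    j<H : n / a < columnHeight M
    j<H = ≤-trans (≤-trans (m<m+n (n / a) (s≤s z≤n)) (≤-reflexive (sym q≡))) (m≤n+m (d * M / a) (threshold M))

  ∈-fewRepresentations⁻ : ∀ {n} → n ∈ fewRepresentations → rc n ≤ p
  ∈-fewRepresentations⁻ {n} n∈ with find (∈-concatMap⁻ residueColumn {xs = upTo a} n∈)
  ... | M , M∈ , n∈col with ∈-map⁻ _ n∈col
  ... | j , j∈ , n≡ with d * M / a ≤? j
  ...   | yes q≤j = subst (λ n → rc n ≤ p) (sym n≡K) (repCount-below-threshold M (j ∸ q) (∈-upTo⁻ M∈) K<T)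
    where
    q = d * M / a
    R = (d * M) % a
    n≡K : n ≡ a * (j ∸ q) + d * M
    n≡K = begin
      n                                ≡⟨ n≡ ⟩
      R + j * a                        ≡⟨ cong (λ z → R + z * a) (m+[n∸m]≡n q≤j) ⟨
      R + (q + (j ∸ q)) * a            ≡⟨ rearrange R q (j ∸ q) a ⟩
      a * (j ∸ q) + (R + q * a)        ≡⟨ cong (a * (j ∸ q) +_) (m≡m%n+[m/n]*n (d * M) a) ⟨
      a * (j ∸ q) + d * M              ∎
      where
      open ≡-Reasoning
      rearrange : ∀ R q K a → R + (q + K) * a ≡ a * K + (R + q * a)
      rearrange = solve-∀
    K<T : j ∸ q < threshold M
    K<T = +-cancelʳ-≤ q (suc (j ∸ q)) (threshold M) (≤-trans (≤-reflexive (cong suc (trans (+-comm (j ∸ q) q) (m+[n∸m]≡n q≤j))))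
                                                              (∈-upTo⁻ j∈))
  ...   | no  q≰j = ≤-trans (≤-reflexive (repCount-below-residue n M gap (∈-upTo⁻ M∈) (sym dM≡))) z≤n
    where
    q = d * M / a
    R = (d * M) % a
    gap = q ∸ suc j
    dM≡ : d * M ≡ n + a * suc gap
    dM≡ = begin
      d * M                            ≡⟨ m≡m%n+[m/n]*n (d * M) a ⟩
      R + q * a                        ≡⟨ cong (λ z → R + z * a) (m+[n∸m]≡n (≰⇒> q≰j)) ⟨
      R + (suc j + gap) * a            ≡⟨ rearrange R j gap a ⟩
      R + j * a + a * suc gap          ≡⟨ cong (_+ a * suc gap) n≡ ⟨
      n + a * suc gap                  ∎
      where
      open ≡-Reasoning
      rearrange : ∀ R q J a → R + (suc q + J) * a ≡ R + q * a + a * suc J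
      rearrange = solve-∀

  countBelow-eventually : ∀ X → frobenius < X → countBelow a (a + d) (a + 2 * d) p X ≡ length fewRepresentations
  countBelow-eventually X frobenius<X = ≤-antisym
    (Unique-⊆⇒length-≤ (Unique.filter⁺ (λ n → rc n ≤? p) (Unique.upTo⁺ X))
      (λ n∈ → ∈-fewRepresentations⁺ _ (proj₂ (∈-filter⁻ (λ n → rc n ≤? p) {xs = upTo X} n∈))))
    (Unique-⊆⇒length-≤ fewRepresentations-Unique
      (λ n∈ → ∈-filter⁺ (λ n → rc n ≤? p) (∈-upTo⁺ (≤-<-trans (≮⇒≥ (λ frobenius<n → <-irrefl refl (<-≤-trans (frobenius-maximal _ frobenius<n) (∈-fewRepresentations⁻ n∈)))) frobenius<X))
                         (∈-fewRepresentations⁻ n∈)))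

  length-fewRepresentations : length fewRepresentations ≡ sumBelow threshold a + sumBelow (λ M → d * M / a) a
  length-fewRepresentations = begin
    length fewRepresentations                              ≡⟨ length-concatMap-applyUpTo residueColumn (λ M → M) a ⟩
    sumBelow (λ M → length (residueColumn M)) a            ≡⟨ sumBelow-cong _ columnHeight a (λ M _ → trans (length-map _ (upTo (columnHeight M))) (length-upTo (columnHeight M))) ⟩
    sumBelow columnHeight a                                ≡⟨ sumBelow-+ threshold (λ M → d * M / a) a ⟩
    sumBelow threshold a + sumBelow (λ M → d * M / a) a    ∎
    where open ≡-Reasoning

  q : ℕ
  q = h ∸ p

  p+q≡h : p + q ≡ h
  p+q≡h = m+[n∸m]≡n p≤a/2

  thresholds-of-pair-high : ∀ i → p ≤ i → threshold (i * 2) + threshold (1 + i * 2) ≡ (i + 0 + p) + (i + 1 + p)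
  thresholds-of-pair-high i p≤i = cong₂ _+_
    (trans (threshold-parity 0 i (s≤s z≤n)) (threshold-high i 0 p≤i))
    (trans (threshold-parity 1 i (s≤s (s≤s z≤n))) (threshold-high i 1 p≤i))

  thresholds-of-pair-low : ∀ i → i < p → threshold (i * 2) + threshold (1 + i * 2) ≡ a₁ + 2 * d + 2 * p
  thresholds-of-pair-low i i<p = begin
    threshold (i * 2) + threshold (1 + i * 2)
      ≡⟨ cong₂ _+_ (trans (threshold-parity 0 i (s≤s z≤n)) (threshold-low i 0 i<p))
                   (trans (threshold-parity 1 i (s≤s (s≤s z≤n))) (threshold-low i 1 i<p)) ⟩
    h + d + (p ∸ 1) + ⌈ s /2⌉ + (h + d + (p ∸ 1) + ⌈ 1 + s /2⌉)
      ≡⟨ cong₂ (λ x y → h + d + (p ∸ 1) + x + (h + d + (p ∸ 1) + y)) ⌈s/2⌉≡s ⌈1+s/2⌉≡1 ⟩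
    h + d + (p ∸ 1) + s + (h + d + (p ∸ 1) + 1)
      ≡⟨ rearrange h d (p ∸ 1) s ⟩
    s + h * 2 + 2 * d + 2 * (p ∸ 1) + 1
      ≡⟨ cong (λ z → z + 2 * d + 2 * (p ∸ 1) + 1) a≡s+h*2 ⟨
    a + 2 * d + 2 * (p ∸ 1) + 1
      ≡⟨ rearrange′ a₁ d (p ∸ 1) ⟩
    a₁ + 2 * d + 2 * suc (p ∸ 1)
      ≡⟨ cong (λ z → a₁ + 2 * d + 2 * z) (m+[n∸m]≡n (≤-trans (s≤s z≤n) i<p)) ⟩
    a₁ + 2 * d + 2 * p  ∎
    where
    open ≡-Reasoning
    rearrange : ∀ h d q s → h + d + q + s + (h + d + q + 1) ≡ s + h * 2 + 2 * d + 2 * q + 1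
    rearrange = solve-∀
    rearrange′ : ∀ a₁ d q → suc a₁ + 2 * d + 2 * q + 1 ≡ a₁ + 2 * d + 2 * suc q
    rearrange′ = solve-∀

  sum-threshold-pairs : sumBelow (λ i → threshold (i * 2) + threshold (1 + i * 2)) h ≡ p * (a₁ + 2 * d + 2 * p) + q * (q + 4 * p)
  sum-threshold-pairs = begin
    sumBelow pair h                                                    ≡⟨ cong (sumBelow pair) p+q≡h ⟨
    sumBelow pair (p + q)                                              ≡⟨ sumBelow-split pair p q ⟩
    sumBelow pair p + sumBelow (λ j → pair (p + j)) q                  ≡⟨ cong₂ _+_ low high ⟩
    p * (a₁ + 2 * d + 2 * p) + q * (q + 4 * p)                         ∎
    where
    open ≡-Reasoning
    pair : ℕ → ℕ
    pair i = threshold (i * 2) + threshold (1 + i * 2)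
    low : sumBelow pair p ≡ p * (a₁ + 2 * d + 2 * p)
    low = trans (sumBelow-cong pair _ p thresholds-of-pair-low) (sumBelow-const _ p)
    rearrange : ∀ p j → p + j + 0 + p + (p + j + 1 + p) ≡ 4 * p + 1 + j * 2
    rearrange = solve-∀
    high : sumBelow (λ j → pair (p + j)) q ≡ q * (q + 4 * p)
    high = trans (sumBelow-cong _ _ q (λ j _ → trans (thresholds-of-pair-high (p + j) (m≤m+n p j)) (rearrange p j)))
                 (sumBelow-odd (4 * p) q)

  sum-threshold-even : s ≡ 0 → sumBelow threshold a ≡ p * (a₁ + 2 * d + 2 * p) + q * (q + 4 * p)
  sum-threshold-even s≡0 = trans (cong (sumBelow threshold) (trans a≡s+h*2 (cong (_+ h * 2) s≡0)))
                                 (trans (sumBelow-pairs threshold h) sum-threshold-pairs)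

  sum-threshold-odd : s ≡ 1 → sumBelow threshold a ≡ p * (a₁ + 2 * d + 2 * p) + q * (q + 4 * p) + (h + 0 + p)
  sum-threshold-odd s≡1 = trans (cong (sumBelow threshold) (trans a≡s+h*2 (cong (_+ h * 2) s≡1)))
    (cong₂ _+_ (trans (sumBelow-pairs threshold h) sum-threshold-pairs)
               (trans (threshold-parity 0 h (s≤s z≤n)) (threshold-high h 0 p≤a/2)))

  floorTotal : ℕ
  floorTotal = sumBelow (λ M → d * M / a) a

  countBelow≡ : ∀ N → frobenius < N → countBelow a (a + d) (a + 2 * d) p N ≡ sumBelow threshold a + floorTotal
  countBelow≡ N frobenius<N = trans (countBelow-eventually N frobenius<N) length-fewRepresentations

  2a+2d∸1≡ : 2 * a + 2 * d ∸ 1 ≡ a₁ + a₁ + 2 * d₀ + 3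
  2a+2d∸1≡ = cong (_∸ 1) (rearrange a₁ d₀)
    where
    rearrange : ∀ a₁ d₀ → 2 * suc a₁ + 2 * suc d₀ ≡ suc (a₁ + a₁ + 2 * d₀ + 3)
    rearrange = solve-∀

  module _ (s≡1 : s ≡ 1) where

    private
      a₁≡h*2 : a₁ ≡ h * 2
      a₁≡h*2 = suc-injective (trans a≡s+h*2 (cong (_+ h * 2) s≡1))

      a₁≡ : (p + q) * 2 ≡ a₁
      a₁≡ = trans (cong (_* 2) p+q≡h) (sym a₁≡h*2)

    floorTotal-odd : floorTotal ≡ h * d₀
    floorTotal-odd = *-cancelʳ-≡ floorTotal (h * d₀) 2 (trans floor-sum (trans (cong (_* d₀) a₁≡h*2) (swap h d₀)))
      where
      swap : ∀ h d₀ → h * 2 * d₀ ≡ h * d₀ * 2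
      swap = solve-∀

    width-odd : 2 * a + 2 * d ∸ 1 ∸ p ≡ 3 * p + 4 * q + 2 * d₀ + 3
    width-odd = trans (cong (_∸ p) (trans 2a+2d∸1≡ (cong (λ z → z + z + 2 * d₀ + 3) (sym a₁≡))))
                      (trans (cong (_∸ p) (rearrange p q d₀)) (m+n∸n≡m _ p))
      where
      rearrange : ∀ p q d₀ → (p + q) * 2 + (p + q) * 2 + 2 * d₀ + 3 ≡ 3 * p + 4 * q + 2 * d₀ + 3 + p
      rearrange = solve-∀

    quarter-odd : (a ∸ 1) * (a + 2 * d ∸ 1) / 4 ≡ (p + q) * (p + q) + (p + q) + (p + q) * d₀
    quarter-odd = trans (cong (λ z → z * (z + 2 * d) / 4) (sym a₁≡)) (trans (cong (_/ 4) (rearrange (p + q) d₀)) (m*n/n≡m _ 4))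
      where
      rearrange : ∀ h d₀ → h * 2 * (h * 2 + 2 * suc d₀) ≡ (h * h + h + h * d₀) * 4
      rearrange = solve-∀

    genus-odd : ∀ N → frobenius < N →
      countBelow a (a + d) (a + 2 * d) p N ≡ (2 * a + 2 * d ∸ 1 ∸ p) * p + ((a ∸ 1) * (a + 2 * d ∸ 1)) / 4
    genus-odd N frobenius<N = begin
      countBelow a (a + d) (a + 2 * d) p N
        ≡⟨ countBelow≡ N frobenius<N ⟩
      sumBelow threshold a + floorTotal
        ≡⟨ cong₂ _+_ (sum-threshold-odd s≡1) floorTotal-odd ⟩
      p * (a₁ + 2 * d + 2 * p) + q * (q + 4 * p) + (h + 0 + p) + h * d₀
        ≡⟨ cong₂ (λ x z → p * (x + 2 * d + 2 * p) + q * (q + 4 * p) + (z + 0 + p) + z * d₀) a₁≡ p+q≡h ⟨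
      p * ((p + q) * 2 + 2 * d + 2 * p) + q * (q + 4 * p) + (p + q + 0 + p) + (p + q) * d₀
        ≡⟨ rearrange p q d₀ ⟩
      (3 * p + 4 * q + 2 * d₀ + 3) * p + ((p + q) * (p + q) + (p + q) + (p + q) * d₀)
        ≡⟨ cong₂ (λ x y → x * p + y) width-odd quarter-odd ⟨
      (2 * a + 2 * d ∸ 1 ∸ p) * p + ((a ∸ 1) * (a + 2 * d ∸ 1)) / 4  ∎
      where
      open ≡-Reasoning
      rearrange : ∀ p q d₀ → p * ((p + q) * 2 + 2 * suc d₀ + 2 * p) + q * (q + 4 * p) + (p + q + 0 + p) + (p + q) * d₀
                ≡ (3 * p + 4 * q + 2 * d₀ + 3) * p + ((p + q) * (p + q) + (p + q) + (p + q) * d₀)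
      rearrange = solve-∀

  module _ (s≡0 : s ≡ 0) where

    private
      a≡h*2 : a ≡ h * 2
      a≡h*2 = trans a≡s+h*2 (cong (_+ h * 2) s≡0)

      a≡ : a ≡ (p + q) * 2
      a≡ = trans a≡h*2 (cong (_* 2) (sym p+q≡h))

    width-even : 2 * a + 2 * d ∸ 1 ∸ p ≡ 3 * p + 4 * q + 2 * d₀ + 1
    width-even = trans (cong (_∸ p) (trans 2a+2d∸1≡ (suc-injective (suc-injective (begin
        suc (suc (a₁ + a₁ + 2 * d₀ + 3))        ≡⟨ rearrange a₁ d₀ ⟩
        a + a + 2 * d₀ + 3                      ≡⟨ cong (λ z → z + z + 2 * d₀ + 3) a≡ ⟩
        (p + q) * 2 + (p + q) * 2 + 2 * d₀ + 3  ≡⟨ rearrange′ p q d₀ ⟩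
        suc (suc (3 * p + 4 * q + 2 * d₀ + 1 + p))  ∎)))))
      (m+n∸n≡m _ p)
      where
      open ≡-Reasoning
      rearrange : ∀ a₁ d₀ → suc (suc (a₁ + a₁ + 2 * d₀ + 3)) ≡ suc a₁ + suc a₁ + 2 * d₀ + 3
      rearrange = solve-∀
      rearrange′ : ∀ p q d₀ → (p + q) * 2 + (p + q) * 2 + 2 * d₀ + 3 ≡ suc (suc (3 * p + 4 * q + 2 * d₀ + 1 + p))
      rearrange′ = solve-∀

    quarter-even : ((a ∸ 1) * (a + 2 * d ∸ 1) + 1) / 4 ≡ h * h + floorTotal
    quarter-even = trans (cong (_/ 4) (begin
        a₁ * (a₁ + 2 * d) + 1                          ≡⟨ rearrange a₁ d₀ ⟩
        a * a + 2 * (a₁ * d₀)                          ≡⟨ cong₂ (λ x y → x * x + 2 * y) a≡h*2 (sym floor-sum) ⟩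
        h * 2 * (h * 2) + 2 * (floorTotal * 2)         ≡⟨ rearrange′ h floorTotal ⟩
        (h * h + floorTotal) * 4                       ∎))
      (m*n/n≡m _ 4)
      where
      open ≡-Reasoning
      rearrange : ∀ a₁ d₀ → a₁ * (a₁ + 2 * suc d₀) + 1 ≡ suc a₁ * suc a₁ + 2 * (a₁ * d₀)
      rearrange = solve-∀
      rearrange′ : ∀ h X → h * 2 * (h * 2) + 2 * (X * 2) ≡ (h * h + X) * 4
      rearrange′ = solve-∀

    pair-sum-even : a₁ + 2 * d + 2 * p ≡ 4 * p + 2 * q + 1 + 2 * d₀
    pair-sum-even = suc-injective (begin
      suc (a₁ + 2 * d + 2 * p)               ≡⟨ rearrange a₁ d₀ p ⟩
      a + 2 * d + 2 * p                      ≡⟨ cong (λ x → x + 2 * d + 2 * p) a≡ ⟩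
      (p + q) * 2 + 2 * d + 2 * p            ≡⟨ rearrange′ p q d₀ ⟩
      suc (4 * p + 2 * q + 1 + 2 * d₀)       ∎)
      where
      open ≡-Reasoning
      rearrange : ∀ a₁ d₀ p → suc (a₁ + 2 * suc d₀ + 2 * p) ≡ suc a₁ + 2 * suc d₀ + 2 * p
      rearrange = solve-∀
      rearrange′ : ∀ p q d₀ → (p + q) * 2 + 2 * suc d₀ + 2 * p ≡ suc (4 * p + 2 * q + 1 + 2 * d₀)
      rearrange′ = solve-∀

    genus-even : ∀ N → frobenius < N →
      countBelow a (a + d) (a + 2 * d) p N ≡ (2 * a + 2 * d ∸ 1 ∸ p) * p + ((a ∸ 1) * (a + 2 * d ∸ 1) + 1) / 4
    genus-even N frobenius<N = begin
      countBelow a (a + d) (a + 2 * d) p N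
        ≡⟨ countBelow≡ N frobenius<N ⟩
      sumBelow threshold a + floorTotal
        ≡⟨ cong (_+ floorTotal) (sum-threshold-even s≡0) ⟩
      p * (a₁ + 2 * d + 2 * p) + q * (q + 4 * p) + floorTotal
        ≡⟨ cong (λ x → p * x + q * (q + 4 * p) + floorTotal) pair-sum-even ⟩
      p * (4 * p + 2 * q + 1 + 2 * d₀) + q * (q + 4 * p) + floorTotal
        ≡⟨ rearrange p q d₀ floorTotal ⟩
      (3 * p + 4 * q + 2 * d₀ + 1) * p + ((p + q) * (p + q) + floorTotal)
        ≡⟨ cong (λ y → (3 * p + 4 * q + 2 * d₀ + 1) * p + (y * y + floorTotal)) p+q≡h ⟩
      (3 * p + 4 * q + 2 * d₀ + 1) * p + (h * h + floorTotal)
        ≡⟨ cong₂ (λ x y → x * p + y) width-even quarter-even ⟨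
      (2 * a + 2 * d ∸ 1 ∸ p) * p + ((a ∸ 1) * (a + 2 * d ∸ 1) + 1) / 4  ∎
      where
      open ≡-Reasoning
      rearrange : ∀ p q d₀ X → p * (4 * p + 2 * q + 1 + 2 * d₀) + q * (q + 4 * p) + X
                ≡ (3 * p + 4 * q + 2 * d₀ + 1) * p + ((p + q) * (p + q) + X)
      rearrange = solve-∀

theorem1 : (a d p : ℕ) → 3 ≤ a → 0 < d → gcd a d ≡ 1 → p ≤ a / 2 →
    -- g_p : the largest n with d(n; A₃) ≤ p equals the formula
    (repCount a (a + d) (a + 2 * d) ((a + 2 * d) * p + ((a ∸ 2) / 2) * a + (a ∸ 1) * d) ≤ p
      × (∀ n → (a + 2 * d) * p + ((a ∸ 2) / 2) * a + (a ∸ 1) * d < n → p < repCount a (a + d) (a + 2 * d) n))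
    -- n_p : the set {n ∈ ℕ | d(n; A₃) ≤ p} is finite with the stated cardinality
    × (a % 2 ≡ 1 → ∃ λ N → ∀ M → N ≤ M →
         countBelow a (a + d) (a + 2 * d) p M ≡ (2 * a + 2 * d ∸ 1 ∸ p) * p + ((a ∸ 1) * (a + 2 * d ∸ 1)) / 4)
    × (a % 2 ≡ 0 → ∃ λ N → ∀ M → N ≤ M →
         countBelow a (a + d) (a + 2 * d) p M ≡ (2 * a + 2 * d ∸ 1 ∸ p) * p + ((a ∸ 1) * (a + 2 * d ∸ 1) + 1) / 4)
theorem1 (suc (suc (suc a₀))) (suc d₀) p (s≤s (s≤s (s≤s _))) (s≤s _) gcd≡1 p≤a/2 =
  (frobenius-repCount≤ , frobenius-maximal) ,
  (λ s≡1 → suc frobenius , genus-odd s≡1) ,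
  (λ s≡0 → suc frobenius , genus-even s≡0)
  where open Sylvester a₀ d₀ gcd≡1 p p≤a/2
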